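{- For integers $0\leq l\leq k$, there is a bijection between the set of $132$-avoiding involutions of length $2k+1$ having exactly $2l+1$ right-to-left maxima and the set of $132$-avoiding involutions of length $2k+2$ having exactly $2l+2$ or $2l+3$ right-to-left maxima.
   Context: An involution of length $n$ is $\pi\in\mathfrak{S}_n$ with $\pi=\pi^{ -1}$ (one-line notation $\pi_1\cdots\pi_n$); it avoids $132$ if there are no $i<j<k$ with $\pi_i<\pi_k<\pi_j$. The entry $\pi_j$ is a right-to-left maximum if $\pi_j>\pi_i$ for all $i$ with $j<i\leq n$. -}

module Defs where

open import Data.Nat using (ℕ)
open import Data.Fin using (Fin; _<_; _<?_)
open import Data.Fin.Properties using (all?; _≟_)
open import Data.Vec using (Vec; lookup; allFin)
open import Data.Vec.Properties using ()
open import Data.List using (List; length; filter)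
open import Data.Product using (_×_; Σ)
open import Relation.Nullary using (¬_; Dec)
open import Relation.Nullary.Decidable using (_→-dec_; _×-dec_; ¬?; True)
import Data.Vec as V
open import Data.List using (upTo)
open import Function using (_∘_)
open import Relation.Binary.PropositionalEquality using (_≡_)

-- A permutation-like word of length n in one-line notation:
-- w = π₁ ⋯ πₙ, with values in Fin n (0-based: value i stands for i+1).
Word : ℕ → Set
Word n = Vec (Fin n) n

-- π is an involution: π (π i) = i for all i (this also forces π to be a bijection,
-- so involutions of length n are exactly the words w with this property).
IsInvolution : ∀ {n} → Word n → Set
IsInvolution {n} w = (i : Fin n) → lookup w (lookup w i) ≡ i

isInvolution? : ∀ {n} (w : Word n) → Dec (IsInvolution w)
isInvolution? w = all? (λ i → lookup w (lookup w i) ≟ i)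

Avoids132 : ∀ {n} → Word n → Set
Avoids132 {n} w = (i j k : Fin n) → i < j → j < k →
  ¬ (lookup w i < lookup w k × lookup w k < lookup w j)

avoids132? : ∀ {n} (w : Word n) → Dec (Avoids132 w)
avoids132? w = all? λ i → all? λ j → all? λ k →
  (i <? j) →-dec ((j <? k) →-dec ¬? ((lookup w i <? lookup w k) ×-dec (lookup w k <? lookup w j)))

IsRLMax : ∀ {n} → Word n → Fin n → Set
IsRLMax {n} w j = (i : Fin n) → j < i → lookup w i < lookup w j

isRLMax? : ∀ {n} (w : Word n) (j : Fin n) → Dec (IsRLMax w j)
isRLMax? w j = all? λ i → (j <? i) →-dec (lookup w i <? lookup w j)

rlMax : ∀ {n} → Word n → ℕ
rlMax {n} w = length (filter (isRLMax? w) (V.toList (allFin n)))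

-- The set of 132-avoiding involutions of length n (decidable properties
-- are recorded via True, so each word appears exactly once).
Inv132 : ℕ → Set
Inv132 n = Σ (Word n) λ w → True (isInvolution? w) × True (avoids132? w)

{-# OPTIONS --safe #-}
-- Call the largest value of a 132-avoiding involution π its maximum. If π fixes its last
-- position, π has a single right-to-left maximum and deleting the last entry leaves an arbitrary
-- 132-avoiding involution. Otherwise the maximum sits in a two-cycle (m, last), and avoiding 132
-- forces a shell of width c = m + 1: the first c positions carry the c largest values, the last
-- c positions the c smallest, and in between sits a 132-avoiding involution, the middle, with two
-- right-to-left maxima fewer than π. Removing that two-cycle thus matches these π with shelled
-- involutions two entries shorter, and a shelled involution is just a pair (outer part, middle).
-- For l > 0 this reduces both sides of the bijection to pairs whose middles are related by the
-- case l - 1, so the proof is an induction on l. For l = 0, π is its fixed last entry plus an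
-- arbitrary involution, which is cut at its widest shell: that is the unique shell whose middle
-- has at most one right-to-left maximum.
module Submission where

open import Defs
open import Data.Bool using (Bool; true; false; T; _∨_; if_then_else_)
open import Data.Bool.Properties using (T-irrelevant; T-∨)
open import Data.Empty using (⊥; ⊥-elim)
open import Data.Fin using (Fin; toℕ; fromℕ<) renaming (zero to fzero; suc to fsuc)
open import Data.Fin.Properties using (toℕ-injective; toℕ<n; toℕ-fromℕ<; fromℕ<-injective; injective⇒≤)
open import Data.List using (length; filter)
open import Data.Nat
open import Data.Nat.Properties
open import Algebra.Properties.CommutativeSemigroup +-commutativeSemigroup using (xy∙z≈xz∙y)
open import Data.Nat.Tactic.RingSolver using (solve-∀)
open import Data.Product using (Σ; ∃; _×_; _,_; proj₁; proj₂)
open import Data.Product.Function.Dependent.Propositional using (Σ-↔)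
open import Data.Product.Function.NonDependent.Propositional using (_×-↔_)
open import Data.Sum using (_⊎_; inj₁; inj₂)
import Data.Sum as Sum
open import Data.Vec using (Vec; []; _∷_; lookup; tabulate; toList)
open import Data.Vec.Properties using (lookup∘tabulate)
open import Function using (_∘_; _⇔_; mk⇔; Equivalence; _↔_; mk↔ₛ′; Inverse; _⤖_)
open import Function.Related.Propositional using (module EquationalReasoning)
open import Function.Properties.Inverse using (↔-refl; ↔⇒⤖)
open import Relation.Binary using (tri<; tri≈; tri>)
open import Relation.Binary.PropositionalEquality
open import Relation.Nullary using (¬_; Dec; yes; no; does; _×-dec_; _→-dec_)
open import Relation.Nullary.Decidable using (True; toWitness; fromWitness; dec-true; dec-false; does-⇔)

count : ℕ → (ℕ → Bool) → ℕ
count zero    p = 0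
count (suc n) p = (if p 0 then 1 else 0) + count n (p ∘ suc)

count-cong : ∀ n {p p′} → (∀ {i} → i < n → p i ≡ p′ i) → count n p ≡ count n p′
count-cong zero    p≡p′ = refl
count-cong (suc n) p≡p′ = cong₂ (λ b c → (if b then 1 else 0) + c) (p≡p′ z<s) (count-cong n (p≡p′ ∘ s<s))

count-+ : ∀ a b p → count (a + b) p ≡ count a p + count b (p ∘ (a +_))
count-+ zero    b p = refl
count-+ (suc a) b p = trans (cong (_ +_) (count-+ a b (p ∘ suc))) (sym (+-assoc (if p 0 then 1 else 0) _ _))

count≤ : ∀ n p → count n p ≤ n
count≤ zero    p = z≤n
count≤ (suc n) p with p 0
... | true  = s≤s (count≤ n (p ∘ suc))
... | false = m≤n⇒m≤1+n (count≤ n (p ∘ suc))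

count-none : ∀ n {p} → (∀ {i} → i < n → p i ≡ false) → count n p ≡ 0
count-none zero    none = refl
count-none (suc n) none rewrite none z<s = count-none n (none ∘ s<s)

count-one : ∀ {p} → p 0 ≡ true → count 1 p ≡ 1
count-one p0 rewrite p0 = refl

count≥1 : ∀ n p {j} → j < n → p j ≡ true → 1 ≤ count n p
count≥1 (suc n) p {zero}  _   pj rewrite pj = s≤s z≤n
count≥1 (suc n) p {suc j} j<n pj = ≤-trans (count≥1 n (p ∘ suc) (s<s⁻¹ j<n) pj) (m≤n+m _ _)

count≥2 : ∀ n p {j k} → j < k → k < n → p j ≡ true → p k ≡ true → 2 ≤ count n p
count≥2 (suc n) p {zero}  {suc k} _   k<n pj pk rewrite pj = s≤s (count≥1 n (p ∘ suc) (s<s⁻¹ k<n) pk)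
count≥2 (suc n) p {suc j} {suc k} j<k k<n pj pk =
  ≤-trans (count≥2 n (p ∘ suc) (s<s⁻¹ j<k) (s<s⁻¹ k<n) pj pk) (m≤n+m _ _)

≤-split : ∀ {a j} → a ≤ j → ∃ λ u → j ≡ a + u
≤-split {a} {j} a≤j = j ∸ a , sym (m+[n∸m]≡n a≤j)

-- Involutions as functions on ℕ

infix 4 _≈[_]_
_≈[_]_ : (ℕ → ℕ) → ℕ → (ℕ → ℕ) → Set
f ≈[ n ] g = ∀ {i} → i < n → f i ≡ g i

≈-sym : ∀ {n f g} → f ≈[ n ] g → g ≈[ n ] f
≈-sym f≈g i<n = sym (f≈g i<n)

≈-trans : ∀ {n f g h} → f ≈[ n ] g → g ≈[ n ] h → f ≈[ n ] h
≈-trans f≈g g≈h i<n = trans (f≈g i<n) (g≈h i<n)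

Bounded : ℕ → (ℕ → ℕ) → Set
Bounded n f = ∀ {i} → i < n → f i < n

Involutive : ℕ → (ℕ → ℕ) → Set
Involutive n f = ∀ {i} → i < n → f (f i) ≡ i

No132 : ℕ → (ℕ → ℕ) → Set
No132 n f = ∀ {i j k} → i < j → j < k → k < n → f i < f k → f k < f j → ⊥

record Is132Inv (n : ℕ) (f : ℕ → ℕ) : Set where
  field
    bounded    : Bounded n f
    involutive : Involutive n f
    no132      : No132 n f

  injective : ∀ {i j} → i < n → j < n → f i ≡ f j → i ≡ j
  injective i<n j<n fi≡fj = trans (sym (involutive i<n)) (trans (cong f fi≡fj) (involutive j<n))

open Is132Inv public

Is132Inv-resp : ∀ {n f g} → f ≈[ n ] g → Is132Inv n f → Is132Inv n g
Is132Inv-resp {f = f} {g} f≈g π = record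
  { bounded    = λ i<n → subst (_< _) (f≈g i<n) (bounded π i<n)
  ; involutive = λ {i} i<n → begin
      g (g i) ≡⟨ cong g (sym (f≈g i<n)) ⟩
      g (f i) ≡⟨ sym (f≈g (bounded π i<n)) ⟩
      f (f i) ≡⟨ involutive π i<n ⟩
      i       ∎
  ; no132      = λ {i} {j} {k} i<j j<k k<n gi<gk gk<gj →
      let j<n = <-trans j<k k<n in
      no132 π i<j j<k k<n
        (subst₂ _<_ (sym (f≈g (<-trans i<j j<n))) (sym (f≈g k<n)) gi<gk)
        (subst₂ _<_ (sym (f≈g k<n)) (sym (f≈g j<n)) gk<gj)
  }
  where open ≡-Reasoning

RLMax : ℕ → (ℕ → ℕ) → ℕ → Set
RLMax n f j = ∀ {i} → i < n → j < i → f i < f j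

rlMax? : ∀ n f j → Dec (RLMax n f j)
rlMax? n f j = allUpTo? (λ i → j <? i →-dec f i <? f j) n

#RLMax : ℕ → (ℕ → ℕ) → ℕ
#RLMax n f = count n (λ j → does (rlMax? n f j))

RLMax-resp : ∀ {n f g j} → f ≈[ n ] g → j < n → RLMax n f j → RLMax n g j
RLMax-resp f≈g j<n rl i<n j<i = subst₂ _<_ (f≈g i<n) (f≈g j<n) (rl i<n j<i)

#RLMax-cong : ∀ {n f g} → f ≈[ n ] g → #RLMax n f ≡ #RLMax n g
#RLMax-cong {n} {f} {g} f≈g = count-cong n λ j<n →
  does-⇔ (mk⇔ (RLMax-resp f≈g j<n) (RLMax-resp (≈-sym f≈g) j<n)) (rlMax? n f _) (rlMax? n g _)

-- Words and 132-avoiding involutions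

-- junk value 0 beyond the end of the word
⟦_⟧ : ∀ {b n} → Vec (Fin b) n → ℕ → ℕ
⟦ []     ⟧ i       = 0
⟦ x ∷ xs ⟧ zero    = toℕ x
⟦ x ∷ xs ⟧ (suc i) = ⟦ xs ⟧ i

⟦⟧-lookup : ∀ {b n} (w : Vec (Fin b) n) (i : Fin n) → ⟦ w ⟧ (toℕ i) ≡ toℕ (lookup w i)
⟦⟧-lookup (x ∷ w) fzero    = refl
⟦⟧-lookup (x ∷ w) (fsuc i) = ⟦⟧-lookup w i

⟦⟧-bounded : ∀ {b n} (w : Vec (Fin b) n) {i} → i < n → ⟦ w ⟧ i < b
⟦⟧-bounded (x ∷ w) {zero}  _   = toℕ<n x
⟦⟧-bounded (x ∷ w) {suc i} i<n = ⟦⟧-bounded w (s<s⁻¹ i<n)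

⟦⟧-injective : ∀ {b n} {w w′ : Vec (Fin b) n} → ⟦ w ⟧ ≈[ n ] ⟦ w′ ⟧ → w ≡ w′
⟦⟧-injective {w = []}    {[]}     _     = refl
⟦⟧-injective {w = x ∷ w} {y ∷ w′} w≈w′ = cong₂ _∷_ (toℕ-injective (w≈w′ z<s)) (⟦⟧-injective (w≈w′ ∘ s<s))

⟦⟧-fromℕ< : ∀ {b n} (w : Vec (Fin b) n) {i} (i<n : i < n) → toℕ (lookup w (fromℕ< i<n)) ≡ ⟦ w ⟧ i
⟦⟧-fromℕ< w {i} i<n = trans (sym (⟦⟧-lookup w _)) (cong ⟦ w ⟧ (toℕ-fromℕ< i<n))

toWord : ∀ n f → Bounded n f → Word n
toWord n f f<n = tabulate λ i → fromℕ< (f<n (toℕ<n i))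

⟦toWord⟧ : ∀ n f (f<n : Bounded n f) → ⟦ toWord n f f<n ⟧ ≈[ n ] f
⟦toWord⟧ n f f<n {i} i<n = begin
  ⟦ w ⟧ i                        ≡⟨ ⟦⟧-fromℕ< w i<n ⟨
  toℕ (lookup w (fromℕ< i<n))    ≡⟨ cong toℕ (lookup∘tabulate _ (fromℕ< i<n)) ⟩
  toℕ (fromℕ< (f<n (toℕ<n (fromℕ< i<n)))) ≡⟨ toℕ-fromℕ< (f<n (toℕ<n (fromℕ< i<n))) ⟩
  f (toℕ (fromℕ< i<n))           ≡⟨ cong f (toℕ-fromℕ< i<n) ⟩
  f i                            ∎
  where open ≡-Reasoning
        w = toWord n f f<n

module _ {n} (w : Word n) where

  IsInvolution⇔Involutive : IsInvolution w ⇔ Involutive n ⟦ w ⟧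
  IsInvolution⇔Involutive = mk⇔ to from
    where
    open ≡-Reasoning
    to : IsInvolution w → Involutive n ⟦ w ⟧
    to inv {i} i<n = begin
      ⟦ w ⟧ (⟦ w ⟧ i)                     ≡⟨ cong ⟦ w ⟧ (⟦⟧-fromℕ< w i<n) ⟨
      ⟦ w ⟧ (toℕ (lookup w (fromℕ< i<n))) ≡⟨ ⟦⟧-lookup w _ ⟩
      toℕ (lookup w (lookup w (fromℕ< i<n))) ≡⟨ cong toℕ (inv _) ⟩
      toℕ (fromℕ< i<n)                    ≡⟨ toℕ-fromℕ< i<n ⟩
      i                                   ∎
    from : Involutive n ⟦ w ⟧ → IsInvolution w
    from inv i = toℕ-injective (begin
      toℕ (lookup w (lookup w i))   ≡⟨ ⟦⟧-lookup w _ ⟨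
      ⟦ w ⟧ (toℕ (lookup w i))      ≡⟨ cong ⟦ w ⟧ (⟦⟧-lookup w i) ⟨
      ⟦ w ⟧ (⟦ w ⟧ (toℕ i))         ≡⟨ inv (toℕ<n i) ⟩
      toℕ i                         ∎)

  Avoids132⇔No132 : Avoids132 w ⇔ No132 n ⟦ w ⟧
  Avoids132⇔No132 = mk⇔ to from
    where
    to : Avoids132 w → No132 n ⟦ w ⟧
    to av {i} {j} {k} i<j j<k k<n wi<wk wk<wj =
      av (fromℕ< i<n) (fromℕ< j<n) (fromℕ< k<n)
        (subst₂ _<_ (sym (toℕ-fromℕ< i<n)) (sym (toℕ-fromℕ< j<n)) i<j)
        (subst₂ _<_ (sym (toℕ-fromℕ< j<n)) (sym (toℕ-fromℕ< k<n)) j<k)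
        ( subst₂ _<_ (sym (⟦⟧-fromℕ< w i<n)) (sym (⟦⟧-fromℕ< w k<n)) wi<wk
        , subst₂ _<_ (sym (⟦⟧-fromℕ< w k<n)) (sym (⟦⟧-fromℕ< w j<n)) wk<wj)
      where j<n = <-trans j<k k<n
            i<n = <-trans i<j j<n
    from : No132 n ⟦ w ⟧ → Avoids132 w
    from no132 i j k i<j j<k (wi<wk , wk<wj) =
      no132 i<j j<k (toℕ<n k)
        (subst₂ _<_ (sym (⟦⟧-lookup w i)) (sym (⟦⟧-lookup w k)) wi<wk)
        (subst₂ _<_ (sym (⟦⟧-lookup w k)) (sym (⟦⟧-lookup w j)) wk<wj)

  IsRLMax⇔RLMax : ∀ j → IsRLMax w j ⇔ RLMax n ⟦ w ⟧ (toℕ j)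
  IsRLMax⇔RLMax j = mk⇔
    (λ rl {i} i<n j<i → subst₂ _<_ (⟦⟧-fromℕ< w i<n) (sym (⟦⟧-lookup w j))
                          (rl (fromℕ< i<n) (subst (toℕ j <_) (sym (toℕ-fromℕ< i<n)) j<i)))
    (λ rl i j<i → subst₂ _<_ (⟦⟧-lookup w i) (⟦⟧-lookup w j) (rl (toℕ<n i) j<i))

  rlMax≡#RLMax : rlMax w ≡ #RLMax n ⟦ w ⟧
  rlMax≡#RLMax = length-filter-tabulate n (λ i → i) λ j →
    does-⇔ (IsRLMax⇔RLMax j) (isRLMax? w j) (rlMax? n ⟦ w ⟧ (toℕ j))
    where
    length-filter-tabulate : ∀ m (f : Fin m → Fin n) {p : ℕ → Bool} →
      (∀ i → does (isRLMax? w (f i)) ≡ p (toℕ i)) → length (filter (isRLMax? w) (toList (tabulate f))) ≡ count m p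
    length-filter-tabulate zero    f agree = refl
    length-filter-tabulate (suc m) f agree with does (isRLMax? w (f fzero)) | agree fzero
    ... | true  | p0 rewrite sym p0 = cong suc (length-filter-tabulate m (f ∘ fsuc) (agree ∘ fsuc))
    ... | false | p0 rewrite sym p0 = length-filter-tabulate m (f ∘ fsuc) (agree ∘ fsuc)

⌊_⌋ : ∀ {n} → Inv132 n → ℕ → ℕ
⌊ p ⌋ = ⟦ proj₁ p ⟧

Inv132⇒Is132Inv : ∀ {n} (p : Inv132 n) → Is132Inv n ⌊ p ⌋
Inv132⇒Is132Inv (w , inv , av) = record
  { bounded    = ⟦⟧-bounded w
  ; involutive = Equivalence.to (IsInvolution⇔Involutive w) (toWitness inv)
  ; no132      = Equivalence.to (Avoids132⇔No132 w) (toWitness av)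
  }

toInv132 : ∀ n f → Is132Inv n f → Inv132 n
toInv132 n f π =
  w , fromWitness (Equivalence.from (IsInvolution⇔Involutive w) (involutive π′))
    , fromWitness (Equivalence.from (Avoids132⇔No132 w) (no132 π′))
  where w  = toWord n f (bounded π)
        π′ = Is132Inv-resp (≈-sym (⟦toWord⟧ n f (bounded π))) π

⌊toInv132⌋ : ∀ n f (π : Is132Inv n f) → ⌊ toInv132 n f π ⌋ ≈[ n ] f
⌊toInv132⌋ n f π = ⟦toWord⟧ n f (bounded π)

Inv132-≡ : ∀ {n} {p p′ : Inv132 n} → ⌊ p ⌋ ≈[ n ] ⌊ p′ ⌋ → p ≡ p′
Inv132-≡ {p = w , _} {w′ , _} p≈p′ with refl ← ⟦⟧-injective {w = w} {w′} p≈p′ =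
  cong (w ,_) (cong₂ _,_ (T-irrelevant _ _) (T-irrelevant _ _))

-- An involution restricted to a closed set of positions P 0 < P 1 < ⋯ < P (a - 1), relabelled along P.
Is132Inv-restrict : ∀ {n g a} → Is132Inv n g → (P Q : ℕ → ℕ) →
  (∀ {x y} → x < y → P x < P y) → (∀ {x} → x < a → P x < n) → (∀ x → Q (P x) ≡ x) →
  (∀ {x} → x < a → Q (g (P x)) < a × P (Q (g (P x))) ≡ g (P x)) →
  Is132Inv a (Q ∘ g ∘ P)
Is132Inv-restrict {g = g} {a} π P Q P-mono P<n Q∘P closed = record
  { bounded    = proj₁ ∘ closed
  ; involutive = λ {x} x<a → begin
      Q (g (P (Q (g (P x))))) ≡⟨ cong (Q ∘ g) (proj₂ (closed x<a)) ⟩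
      Q (g (g (P x)))         ≡⟨ cong Q (involutive π (P<n x<a)) ⟩
      Q (P x)                 ≡⟨ Q∘P x ⟩
      x                       ∎
  ; no132      = λ i<j j<k k<a hi<hk hk<hj →
      let j<a = <-trans j<k k<a in
      no132 π (P-mono i<j) (P-mono j<k) (P<n k<a)
        (reflect (<-trans i<j j<a) k<a hi<hk) (reflect k<a j<a hk<hj)
  }
  where
  open ≡-Reasoning
  reflect : ∀ {x y} → x < a → y < a → Q (g (P x)) < Q (g (P y)) → g (P x) < g (P y)
  reflect x<a y<a lt = subst₂ _<_ (proj₂ (closed x<a)) (proj₂ (closed y<a)) (P-mono lt)

-- The last entry

below-max : ∀ {M f} → Is132Inv (suc M) f → ∀ {j} → j < suc M → j ≢ f M → f j < M
below-max {M} {f} π j<1+M j≢fM = ≤∧≢⇒< (s≤s⁻¹ (bounded π j<1+M)) λ fj≡M →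
  j≢fM (injective π j<1+M (bounded π (n<1+n M)) (trans fj≡M (sym (involutive π (n<1+n M)))))

RLMax-last : ∀ {M f} → RLMax (suc M) f M
RLMax-last i<1+M M<i = ⊥-elim (<⇒≱ M<i (s≤s⁻¹ i<1+M))

module LastEntry {M f} (π : Is132Inv (suc M) f) where

  private
    isRL : ℕ → Bool
    isRL j = does (rlMax? (suc M) f j)

    M<1+M = n<1+n M

  #RLMax-fixed : f M ≡ M → #RLMax (suc M) f ≡ 1
  #RLMax-fixed fM≡M = begin
    count (suc M) isRL                     ≡⟨ cong (λ n → count n isRL) (+-comm 1 M) ⟩
    count (M + 1) isRL                     ≡⟨ count-+ M 1 isRL ⟩
    count M isRL + count 1 (isRL ∘ (M +_)) ≡⟨ cong₂ _+_ (count-none M not-RL) (count-one {isRL ∘ (M +_)} last-RL) ⟩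
    1                                      ∎
    where
    open ≡-Reasoning
    not-RL : ∀ {j} → j < M → isRL j ≡ false
    not-RL {j} j<M = dec-false (rlMax? (suc M) f j) λ rl →
      <-asym (rl M<1+M j<M) (subst (f j <_) (sym fM≡M)
        (below-max π (m<n⇒m<1+n j<M) (<⇒≢ (subst (j <_) (sym fM≡M) j<M))))
    last-RL : isRL (M + 0) ≡ true
    last-RL = subst (λ j → isRL j ≡ true) (sym (+-identityʳ M)) (dec-true (rlMax? (suc M) f M) RLMax-last)

  2≤#RLMax-moved : f M ≢ M → 2 ≤ #RLMax (suc M) f
  2≤#RLMax-moved fM≢M = count≥2 (suc M) isRL fM<M M<1+M
    (dec-true (rlMax? (suc M) f (f M)) RL-fM) (dec-true (rlMax? (suc M) f M) RLMax-last)
    where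
    fM<M = ≤∧≢⇒< (s≤s⁻¹ (bounded π M<1+M)) fM≢M
    RL-fM : RLMax (suc M) f (f M)
    RL-fM {i} i<1+M fM<i rewrite involutive π M<1+M = below-max π i<1+M (<⇒≢ fM<i ∘ sym)

appendFixed : ℕ → (ℕ → ℕ) → ℕ → ℕ
appendFixed n g i = if does (i <? n) then g i else n

module _ {n : ℕ} {g : ℕ → ℕ} where

  appendFixed-< : ∀ {i} → i < n → appendFixed n g i ≡ g i
  appendFixed-< {i} i<n rewrite dec-true (i <? n) i<n = refl

  appendFixed-last : appendFixed n g n ≡ n
  appendFixed-last rewrite dec-false (n <? n) (<-irrefl refl) = refl

  appendFixed-is132Inv : Is132Inv n g → Is132Inv (suc n) (appendFixed n g)
  appendFixed-is132Inv π = record { bounded = bounded′ ; involutive = involutive′ ; no132 = no132′ }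
    where
    bounded′ : Bounded (suc n) (appendFixed n g)
    bounded′ i<1+n with m≤n⇒m<n∨m≡n (s≤s⁻¹ i<1+n)
    ... | inj₁ i<n  = subst (_< suc n) (sym (appendFixed-< i<n)) (m<n⇒m<1+n (bounded π i<n))
    ... | inj₂ refl = subst (_< suc n) (sym appendFixed-last) (n<1+n n)
    involutive′ : Involutive (suc n) (appendFixed n g)
    involutive′ i<1+n with m≤n⇒m<n∨m≡n (s≤s⁻¹ i<1+n)
    ... | inj₁ i<n  rewrite appendFixed-< i<n | appendFixed-< (bounded π i<n) = involutive π i<n
    ... | inj₂ refl rewrite appendFixed-last = appendFixed-last
    no132′ : No132 (suc n) (appendFixed n g)
    no132′ {i} {j} {k} i<j j<k k<1+n ai<ak ak<aj with m≤n⇒m<n∨m≡n (s≤s⁻¹ k<1+n)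
    ... | inj₂ refl = <⇒≱ (subst₂ _<_ appendFixed-last (appendFixed-< j<k) ak<aj) (<⇒≤ (bounded π j<k))
    ... | inj₁ k<n  = no132 π i<j j<k k<n
      (subst₂ _<_ (appendFixed-< (<-trans i<j j<n)) (appendFixed-< k<n) ai<ak)
      (subst₂ _<_ (appendFixed-< k<n) (appendFixed-< j<n) ak<aj)
      where j<n = <-trans j<k k<n

appendFixed-cong : ∀ {n g g′} → g ≈[ n ] g′ → appendFixed n g ≈[ suc n ] appendFixed n g′
appendFixed-cong {n} {g} {g′} g≈g′ i<1+n with m≤n⇒m<n∨m≡n (s≤s⁻¹ i<1+n)
... | inj₁ i<n  = trans (appendFixed-< {n} {g} i<n) (trans (g≈g′ i<n) (sym (appendFixed-< {n} {g′} i<n)))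
... | inj₂ refl = trans (appendFixed-last {n} {g}) (sym (appendFixed-last {n} {g′}))

appendFixed-init : ∀ {n f} → f n ≡ n → appendFixed n f ≈[ suc n ] f
appendFixed-init {n} {f} fn≡n i<1+n with m≤n⇒m<n∨m≡n (s≤s⁻¹ i<1+n)
... | inj₁ i<n  = appendFixed-< {n} {f} i<n
... | inj₂ refl = trans (appendFixed-last {n} {f}) (sym fn≡n)

init-is132Inv : ∀ {n f} → Is132Inv (suc n) f → f n ≡ n → Is132Inv n f
init-is132Inv {n} π fn≡n = Is132Inv-restrict π (λ x → x) (λ x → x) (λ x<y → x<y) m<n⇒m<1+n (λ _ → refl)
  λ x<n → below-max π (m<n⇒m<1+n x<n) (<⇒≢ (subst (_ <_) (sym fn≡n) x<n)) , refl

-- Shells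

Shell : ℕ → ℕ → (ℕ → ℕ) → Set
Shell c r f = (∀ {i} → i < c → c + r ≤ f i) × (∀ {u} → u < c → f (c + r + u) < c)

middle : ℕ → (ℕ → ℕ) → ℕ → ℕ
middle c g t = g (c + t) ∸ c

middle-width-unique : ∀ {c r r′} → c + r + c ≡ c + r′ + c → r ≡ r′
middle-width-unique {c} {r} {r′} eq = +-cancelˡ-≡ c r r′ (+-cancelʳ-≡ c (c + r) (c + r′) eq)

Shell-resp : ∀ {n c r f f′} → n ≡ c + r + c → f ≈[ n ] f′ → Shell c r f → Shell c r f′
Shell-resp {n} {c} {r} n≡ f≈f′ (top , bottom) =
  (λ i<c → subst (c + r ≤_) (f≈f′ (<-≤-trans i<c c≤n)) (top i<c)) ,
  (λ {u} u<c → subst (_< c) (f≈f′ (subst (c + r + u <_) (sym n≡) (+-monoʳ-< (c + r) u<c))) (bottom u<c))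
  where c≤n = subst (c ≤_) (sym n≡) (m≤n+m c (c + r))

injection⇒≤ : ∀ {a lo hi} (g : ℕ → ℕ) → (∀ {t} → t < a → lo ≤ g t × g t < hi) →
              (∀ {s t} → s < a → t < a → g s ≡ g t → s ≡ t) → lo ≤ hi → lo + a ≤ hi
injection⇒≤ {a} {lo} {hi} g range inj lo≤hi = begin
  lo + a         ≤⟨ +-monoʳ-≤ lo (injective⇒≤ {f = h} h-injective) ⟩
  lo + (hi ∸ lo) ≡⟨ m+[n∸m]≡n lo≤hi ⟩
  hi             ∎
  where
  open ≤-Reasoning
  h : Fin a → Fin (hi ∸ lo)
  h i = fromℕ< (∸-monoˡ-< (proj₂ (range (toℕ<n i))) (proj₁ (range (toℕ<n i))))
  h-injective : ∀ {i j} → h i ≡ h j → i ≡ j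
  h-injective {i} {j} hi≡hj = toℕ-injective (inj (toℕ<n i) (toℕ<n j)
    (∸-cancelʳ-≡ (proj₁ (range (toℕ<n i))) (proj₁ (range (toℕ<n j))) (fromℕ<-injective _ _ _ _ hi≡hj)))

module TopCycle {M f} (π : Is132Inv (suc M) f) (moved : f M ≢ M) where

  private
    m = f M
    M<1+M = n<1+n M

  m<M : f M < M
  m<M = ≤∧≢⇒< (s≤s⁻¹ (bounded π M<1+M)) moved

  private
    m<1+M = m<n⇒m<1+n m<M

    fm≡M : f m ≡ M
    fm≡M = involutive π M<1+M

    injective< : ∀ {a s t} → a ≤ M → s < a → t < a → f s ≡ f t → s ≡ t
    injective< a≤M s<a t<a = injective π (<-≤-trans s<a (m≤n⇒m≤1+n a≤M)) (<-≤-trans t<a (m≤n⇒m≤1+n a≤M))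

    -- (i, m, j) would be a 132 pattern, as f m = M is the maximum
    dominated : ∀ {i j} → i < m → m < j → j < suc M → f j < f i
    dominated {i} {j} i<m m<j j<1+M with <-cmp (f i) (f j)
    ... | tri< fi<fj _ _ = ⊥-elim (no132 π i<m m<j j<1+M fi<fj
                             (subst (f j <_) (sym fm≡M) (below-max π j<1+M (<⇒≢ m<j ∘ sym))))
    ... | tri≈ _ fi≡fj _ = ⊥-elim (<⇒≢ (<-trans i<m m<j)
                             (injective π (<-trans i<m (<-trans m<j j<1+M)) j<1+M fi≡fj))
    ... | tri> _ _ fj<fi = fj<fi

    -- f maps the m positions below m injectively into the values strictly between m and M
    size : suc m + m ≤ M
    size = injection⇒≤ f (λ t<m → dominated t<m m<M M<1+M , below-max π (<-trans t<m m<1+M) (<⇒≢ t<m))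
                         (injective< (<⇒≤ m<M)) m<M

  s : ℕ
  s = M ∸ (suc m + m)

  private
    K = suc m + s

    K+m≡M : K + m ≡ M
    K+m≡M = trans (xy∙z≈xz∙y (suc m) s m) (m+[n∸m]≡n size)

    K+u<M : ∀ {u} → u < m → K + u < M
    K+u<M {u} u<m = subst (K + u <_) K+m≡M (+-monoʳ-< K u<m)

    -- if f i < K, the m + 1 positions f i, …, f i + m would all be mapped below m
    top-outer : ∀ {i} → i < m → K ≤ f i
    top-outer {i} i<m with f i <? K
    ... | no  fi≮K = ≮⇒≥ fi≮K
    ... | yes fi<K = ⊥-elim (<-irrefl refl (injection⇒≤ (λ t → f (v + t)) (λ t≤m → z≤n , below t≤m) inj z≤n))
      where
      v = f i
      v+t<M : ∀ {t} → t < suc m → v + t < M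
      v+t<M {t} t≤m = ≤-<-trans (+-monoʳ-≤ v (s≤s⁻¹ t≤m)) (subst (v + m <_) K+m≡M (+-monoˡ-< m fi<K))
      below : ∀ {t} → t < suc m → f (v + t) < m
      below {t} t≤m with <-cmp (f (v + t)) m
      ... | tri< lt _ _ = lt
      ... | tri≈ _ eq _ = ⊥-elim (<⇒≢ (v+t<M t≤m) (injective π (m<n⇒m<1+n (v+t<M t≤m)) M<1+M eq))
      ... | tri> _ _ gt = ⊥-elim (<⇒≱ (subst (_< v) (involutive π (m<n⇒m<1+n (v+t<M t≤m)))
                                         (dominated i<m gt (bounded π (m<n⇒m<1+n (v+t<M t≤m)))))
                                      (m≤m+n v t))
      inj : ∀ {t t′} → t < suc m → t′ < suc m → f (v + t) ≡ f (v + t′) → t ≡ t′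
      inj t≤m t′≤m eq = +-cancelˡ-≡ v _ _ (injective π (m<n⇒m<1+n (v+t<M t≤m)) (m<n⇒m<1+n (v+t<M t′≤m)) eq)

    -- if f (K + u) > m, the m values f t, t < m, would all lie strictly between K + u and M
    bottom-outer : ∀ {u} → u < m → f (K + u) < m
    bottom-outer {u} u<m with <-cmp (f (K + u)) m
    ... | tri< lt _ _ = lt
    ... | tri≈ _ eq _ = ⊥-elim (<⇒≢ (K+u<M u<m) (injective π (m<n⇒m<1+n (K+u<M u<m)) M<1+M eq))
    ... | tri> _ _ gt = ⊥-elim (<⇒≱ (injection⇒≤ f above (injective< (<⇒≤ m<M)) (K+u<M u<m)) M≤x+m)
      where
      x = K + u
      above : ∀ {t} → t < m → suc x ≤ f t × f t < M
      above t<m = subst (_< f _) (involutive π (m<n⇒m<1+n (K+u<M u<m)))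
                  (dominated t<m gt (bounded π (m<n⇒m<1+n (K+u<M u<m))))
                , below-max π (<-trans t<m m<1+M) (<⇒≢ t<m)
      M≤x+m : M ≤ x + m
      M≤x+m = subst (_≤ x + m) K+m≡M (+-monoˡ-≤ m (m≤m+n K u))

  shell : suc M ≡ suc m + s + suc m × Shell (suc m) s f
  shell = trans (cong suc (sym K+m≡M)) (sym (+-suc K m)) , top , bottom
    where
    top : ∀ {i} → i < suc m → K ≤ f i
    top {i} i≤m with m≤n⇒m<n∨m≡n (s≤s⁻¹ i≤m)
    ... | inj₁ i<m  = top-outer i<m
    ... | inj₂ refl = subst (K ≤_) (sym fm≡M) (subst (K ≤_) K+m≡M (m≤m+n K m))
    bottom : ∀ {u} → u < suc m → f (K + u) < suc m
    bottom {u} u≤m with m≤n⇒m<n∨m≡n (s≤s⁻¹ u≤m)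
    ... | inj₁ u<m  = m<n⇒m<1+n (bottom-outer u<m)
    ... | inj₂ refl = subst (λ x → f x < suc m) (sym K+m≡M) (n<1+n m)

module ShellFacts {n c r g} (n≡ : n ≡ c + r + c) (π : Is132Inv n g) (shell : Shell c r g) where

  c≤n : c ≤ n
  c≤n = subst (c ≤_) (sym n≡) (m≤n+m c (c + r))

  c+r≤n : c + r ≤ n
  c+r≤n = subst (c + r ≤_) (sym n≡) (m≤m+n (c + r) c)

  first→top : ∀ {i} → i < c → c + r ≤ g i
  first→top = proj₁ shell

  last→bottom : ∀ {j} → c + r ≤ j → j < n → g j < c
  last→bottom c+r≤j j<n with _ , refl ← ≤-split c+r≤j =
    proj₂ shell (+-cancelˡ-< (c + r) _ c (subst (_ <_) n≡ j<n))

  bottom→last : ∀ {j} → j < n → g j < c → c + r ≤ j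
  bottom→last j<n gj<c = subst (c + r ≤_) (involutive π j<n) (first→top gj<c)

  middle→middle : ∀ {j} → c ≤ j → j < c + r → c ≤ g j × g j < c + r
  middle→middle {j} c≤j j<c+r = ≮⇒≥ not-bottom , ≰⇒> not-top
    where
    j<n = <-≤-trans j<c+r c+r≤n
    not-bottom : g j ≮ c
    not-bottom gj<c = <⇒≱ j<c+r (bottom→last j<n gj<c)
    not-top : c + r ≰ g j
    not-top c+r≤gj = <⇒≱ (subst (_< c) (involutive π j<n) (last→bottom c+r≤gj (bounded π j<n))) c≤j

  notFirst→notTop : ∀ {j} → c ≤ j → j < n → g j < c + r
  notFirst→notTop {j} c≤j j<n with j <? c + r
  ... | yes j<c+r = proj₂ (middle→middle c≤j j<c+r)
  ... | no  j≮c+r = <-≤-trans (last→bottom (≮⇒≥ j≮c+r) j<n) (m≤m+n c r)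

-- Inserting and deleting the two-cycle through the maximum

punchIn : ℕ → ℕ → ℕ
punchIn zero    v       = suc v
punchIn (suc c) zero    = zero
punchIn (suc c) (suc v) = suc (punchIn c v)

punchOut : ℕ → ℕ → ℕ
punchOut zero    v       = pred v
punchOut (suc c) zero    = zero
punchOut (suc c) (suc v) = suc (punchOut c v)

punchIn-below : ∀ {c v} → v < c → punchIn c v ≡ v
punchIn-below {suc c} {zero}  _   = refl
punchIn-below {suc c} {suc v} v<c = cong suc (punchIn-below (s<s⁻¹ v<c))

punchIn-above : ∀ {c v} → c ≤ v → punchIn c v ≡ suc v
punchIn-above {zero}          _   = refl
punchIn-above {suc c} {suc v} c≤v = cong suc (punchIn-above (s≤s⁻¹ c≤v))

punchOut-below : ∀ {c v} → v < c → punchOut c v ≡ v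
punchOut-below {suc c} {zero}  _   = refl
punchOut-below {suc c} {suc v} v<c = cong suc (punchOut-below (s<s⁻¹ v<c))

punchOut-above : ∀ {c v} → c < v → punchOut c v ≡ pred v
punchOut-above {zero}          _   = refl
punchOut-above {suc c} {suc zero}    (s≤s ())
punchOut-above {suc c} {suc (suc v)} c<v = cong suc (punchOut-above (s<s⁻¹ c<v))

punchOut-punchIn : ∀ c v → punchOut c (punchIn c v) ≡ v
punchOut-punchIn zero    v       = refl
punchOut-punchIn (suc c) zero    = refl
punchOut-punchIn (suc c) (suc v) = cong suc (punchOut-punchIn c v)

punchIn-punchOut : ∀ {c v} → v ≢ c → punchIn c (punchOut c v) ≡ v
punchIn-punchOut {zero}  {zero}  v≢c = ⊥-elim (v≢c refl)
punchIn-punchOut {zero}  {suc v} _   = refl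
punchIn-punchOut {suc c} {zero}  _   = refl
punchIn-punchOut {suc c} {suc v} v≢c = cong suc (punchIn-punchOut (v≢c ∘ cong suc))

punchIn-mono-< : ∀ c {a b} → a < b → punchIn c a < punchIn c b
punchIn-mono-< zero                    a<b = s<s a<b
punchIn-mono-< (suc c) {zero}  {suc b} _   = z<s
punchIn-mono-< (suc c) {suc a} {suc b} a<b = s<s (punchIn-mono-< c (s<s⁻¹ a<b))

punchIn-cancel-< : ∀ c {a b} → punchIn c a < punchIn c b → a < b
punchIn-cancel-< zero                    lt = s<s⁻¹ lt
punchIn-cancel-< (suc c) {zero}  {suc b} _  = z<s
punchIn-cancel-< (suc c) {suc a} {suc b} lt = s<s (punchIn-cancel-< c (s<s⁻¹ lt))

punchIn≢ : ∀ c v → punchIn c v ≢ c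
punchIn≢ (suc c) (suc v) eq = punchIn≢ c v (suc-injective eq)

punchIn-≤ : ∀ c {v n} → v < n → punchIn c v ≤ n
punchIn-≤ zero                    v<n = v<n
punchIn-≤ (suc c) {zero}          _   = z≤n
punchIn-≤ (suc c) {suc v} {suc n} v<n = s≤s (punchIn-≤ c (s<s⁻¹ v<n))

punchIn-<⁻¹ : ∀ c {v} → punchIn c v < c → v < c
punchIn-<⁻¹ (suc c) {zero}  _  = z<s
punchIn-<⁻¹ (suc c) {suc v} lt = s<s (punchIn-<⁻¹ c (s<s⁻¹ lt))

punchOut-< : ∀ {c v n} → c ≤ n → v < suc n → v ≢ c → punchOut c v < n
punchOut-< {zero}  {zero}          _   _     v≢c = ⊥-elim (v≢c refl)
punchOut-< {zero}  {suc v}         _   v<1+n _   = s<s⁻¹ v<1+n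
punchOut-< {suc c} {zero}  {suc n} _   _     _   = z<s
punchOut-< {suc c} {suc v} {suc n} c≤n v<1+n v≢c = s<s (punchOut-< (s≤s⁻¹ c≤n) (s<s⁻¹ v<1+n) (v≢c ∘ cong suc))

data TopView (c n : ℕ) : ℕ → Set where
  at-c       : TopView c n c
  at-last    : TopView c n (suc n)
  at-punchIn : ∀ {p} → p < n → TopView c n (punchIn c p)

topView : ∀ {c n p} → c ≤ n → p < suc (suc n) → TopView c n p
topView {c} {n} {p} c≤n p<2+n with p ≟ c | p ≟ suc n
... | yes refl | _        = at-c
... | no _     | yes refl = at-last
... | no p≢c   | no p≢1+n = subst (TopView c n) (punchIn-punchOut p≢c)
                              (at-punchIn (punchOut-< c≤n (≤∧≢⇒< (s≤s⁻¹ p<2+n) p≢1+n) p≢c))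

insertTop : ℕ → ℕ → (ℕ → ℕ) → ℕ → ℕ
insertTop c n g i =
  if does (i ≟ c) then suc n else if does (i ≟ suc n) then c else punchIn c (g (punchOut c i))

deleteTop : ℕ → (ℕ → ℕ) → ℕ → ℕ
deleteTop n f i = punchOut (f (suc n)) (f (punchIn (f (suc n)) i))

module _ {c n : ℕ} {g : ℕ → ℕ} where

  insertTop-c : insertTop c n g c ≡ suc n
  insertTop-c rewrite dec-true (c ≟ c) refl = refl

  insertTop-last : c ≤ n → insertTop c n g (suc n) ≡ c
  insertTop-last c≤n rewrite dec-false (suc n ≟ c) (<⇒≢ (s≤s c≤n) ∘ sym) | dec-true (suc n ≟ suc n) refl = refl

  insertTop-punchIn : ∀ {p} → p < n → insertTop c n g (punchIn c p) ≡ punchIn c (g p)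
  insertTop-punchIn {p} p<n
    rewrite dec-false (punchIn c p ≟ c) (punchIn≢ c p)
          | dec-false (punchIn c p ≟ suc n) (<⇒≢ (s≤s (punchIn-≤ c p<n)))
          | punchOut-punchIn c p = refl

insertTop-cong : ∀ {c n g g′} → c ≤ n → g ≈[ n ] g′ → insertTop c n g ≈[ suc (suc n) ] insertTop c n g′
insertTop-cong {c} {n} {g} {g′} c≤n g≈g′ p<2+n with topView c≤n p<2+n
... | at-c           = trans (insertTop-c {c} {n} {g}) (sym (insertTop-c {c} {n} {g′}))
... | at-last        = trans (insertTop-last {c} {n} {g} c≤n) (sym (insertTop-last {c} {n} {g′} c≤n))
... | at-punchIn p<n = trans (insertTop-punchIn {c} {n} {g} p<n)
                             (trans (cong (punchIn c) (g≈g′ p<n)) (sym (insertTop-punchIn {c} {n} {g′} p<n)))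

deleteTop-cong : ∀ {n f f′} → f ≈[ suc (suc n) ] f′ → deleteTop n f ≈[ n ] deleteTop n f′
deleteTop-cong {n} {f} {f′} f≈f′ i<n rewrite f≈f′ (n<1+n (suc n)) =
  cong (punchOut (f′ (suc n))) (f≈f′ (m<n⇒m<1+n (s≤s (punchIn-≤ (f′ (suc n)) i<n))))

deleteTop-insertTop : ∀ {c n g} → c ≤ n → deleteTop n (insertTop c n g) ≈[ n ] g
deleteTop-insertTop {c} {n} {g} c≤n {i} i<n
  rewrite insertTop-last {c} {n} {g} c≤n | insertTop-punchIn {c} {n} {g} i<n = punchOut-punchIn c (g i)

module InsertTop {n c r g} (n≡ : n ≡ c + r + c) (π : Is132Inv n g) (shell : Shell c r g) where
  open ShellFacts n≡ π shell

  private
    N = suc (suc n)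
    H = insertTop c n g

    H-c : H c ≡ suc n
    H-c = insertTop-c {c} {n} {g}

    H-last : H (suc n) ≡ c
    H-last = insertTop-last {c} {n} {g} c≤n

    H-punchIn : ∀ {p} → p < n → H (punchIn c p) ≡ punchIn c (g p)
    H-punchIn = insertTop-punchIn {c} {n} {g}

    H≤n : ∀ {p} → p < N → p ≢ c → H p ≤ n
    H≤n p<N p≢c with topView c≤n p<N
    ... | at-c           = ⊥-elim (p≢c refl)
    ... | at-last        = subst (_≤ n) (sym H-last) c≤n
    ... | at-punchIn p<n = subst (_≤ n) (sym (H-punchIn p<n)) (punchIn-≤ c (bounded π p<n))

    H-first : ∀ {i} → i < c → H i ≡ suc (g i)
    H-first {i} i<c = begin
      H i             ≡⟨ cong H (punchIn-below i<c) ⟨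
      H (punchIn c i) ≡⟨ H-punchIn (<-≤-trans i<c c≤n) ⟩
      punchIn c (g i) ≡⟨ punchIn-above (≤-trans (m≤m+n c r) (first→top i<c)) ⟩
      suc (g i)       ∎
      where open ≡-Reasoning

    bounded′ : Bounded N H
    bounded′ {p} p<N with p ≟ c
    ... | yes refl = subst (_< N) (sym H-c) (n<1+n (suc n))
    ... | no  p≢c  = s≤s (m≤n⇒m≤1+n (H≤n p<N p≢c))

    involutive′ : Involutive N H
    involutive′ p<N with topView c≤n p<N
    ... | at-c    rewrite H-c    = H-last
    ... | at-last rewrite H-last = H-c
    ... | at-punchIn p<n rewrite H-punchIn p<n | H-punchIn (bounded π p<n) | involutive π p<n = refl

    after-last-block : ∀ {i′ j} → c + r ≤ i′ → punchIn c i′ < j → j < suc n → H j < c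
    after-last-block {i′} c+r≤i′ i<j j<1+n with topView c≤n (m<n⇒m<1+n j<1+n)
    ... | at-c    = ⊥-elim (<⇒≱ i<j (subst (c ≤_) (sym (punchIn-above c≤i′)) (m≤n⇒m≤1+n c≤i′)))
      where c≤i′ = ≤-trans (m≤m+n c r) c+r≤i′
    ... | at-last = ⊥-elim (<-irrefl refl j<1+n)
    ... | at-punchIn {j′} j′<n = subst (_< c) (sym (trans (H-punchIn j′<n) (punchIn-below gj′<c))) gj′<c
      where gj′<c = last→bottom (≤-trans c+r≤i′ (<⇒≤ (punchIn-cancel-< c i<j))) j′<n

    -- a 132 pattern whose 2 is the entry c at the last position
    no132-last : ∀ {i j} → i < j → j < suc n → H i < c → c < H j → ⊥
    no132-last {i} {j} i<j j<1+n Hi<c c<Hj with topView c≤n (<-trans i<j (m<n⇒m<1+n j<1+n))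
    ... | at-c    = <⇒≱ (subst (_< c) H-c Hi<c) (m≤n⇒m≤1+n c≤n)
    ... | at-last = <-asym i<j j<1+n
    ... | at-punchIn i′<n = <-asym c<Hj (after-last-block c+r≤i′ i<j j<1+n)
      where c+r≤i′ = bottom→last i′<n (punchIn-<⁻¹ c (subst (_< c) (H-punchIn i′<n) Hi<c))

    -- a 132 pattern whose 3 is the maximum, at position c
    no132-c : ∀ {i k′} → i < c → c < punchIn c k′ → k′ < n → H i < H (punchIn c k′) → ⊥
    no132-c {i} {k′} i<c c<k k′<n Hi<Hk = <⇒≱ Hi<Hk (begin
      H (punchIn c k′) ≡⟨ H-punchIn k′<n ⟩
      punchIn c (g k′) ≤⟨ punchIn-≤ c (notFirst→notTop c≤k′ k′<n) ⟩
      c + r            ≤⟨ first→top i<c ⟩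
      g i              ≤⟨ n≤1+n (g i) ⟩
      suc (g i)        ≡⟨ H-first i<c ⟨
      H i              ∎)
      where
      open ≤-Reasoning
      c≤k′ : c ≤ k′
      c≤k′ = ≮⇒≥ λ k′<c → <-asym c<k (subst (_< c) (sym (punchIn-below k′<c)) k′<c)

    no132′ : No132 N H
    no132′ {i} {j} {k} i<j j<k k<N Hi<Hk Hk<Hj with topView c≤n k<N
    ... | at-c    = <⇒≱ (subst (_< H j) H-c Hk<Hj) (s≤s⁻¹ (bounded′ (<-trans j<k k<N)))
    ... | at-last = no132-last i<j j<k Hi<Hk′ Hk<Hj′
      where Hi<Hk′ = subst (H i <_) H-last Hi<Hk
            Hk<Hj′ = subst (_< H j) H-last Hk<Hj
    ... | at-punchIn {k′} k′<n with topView c≤n (<-trans j<k k<N)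
    ...   | at-c    = no132-c i<j j<k k′<n Hi<Hk
    ...   | at-last = <⇒≱ j<k (≤-trans (punchIn-≤ c k′<n) (n≤1+n n))
    ...   | at-punchIn j′<n with topView c≤n (<-trans i<j (<-trans j<k k<N))
    ...     | at-c    = <⇒≱ (subst (_< H (punchIn c k′)) H-c Hi<Hk) (m≤n⇒m≤1+n (H≤n k<N (punchIn≢ c k′)))
    ...     | at-last = <⇒≱ i<j (≤-trans (punchIn-≤ c j′<n) (n≤1+n n))
    ...     | at-punchIn i′<n = no132 π (punchIn-cancel-< c i<j) (punchIn-cancel-< c j<k) k′<n
                (punchIn-cancel-< c (subst₂ _<_ (H-punchIn i′<n) (H-punchIn k′<n) Hi<Hk))
                (punchIn-cancel-< c (subst₂ _<_ (H-punchIn k′<n) (H-punchIn j′<n) Hk<Hj))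

  is132Inv : Is132Inv N H
  is132Inv = record { bounded = bounded′ ; involutive = involutive′ ; no132 = no132′ }

  private
    isRL : ℕ → Bool
    isRL j = does (rlMax? N H j)

    middle-≥ : ∀ {t} → t < r → c ≤ g (c + t)
    middle-≥ {t} t<r = proj₁ (middle→middle (m≤m+n c t) (+-monoʳ-< c t<r))

    H-middle : ∀ {s} → s < r → H (c + suc s) ≡ suc (g (c + s))
    H-middle {s} s<r = begin
      H (c + suc s)          ≡⟨ cong H (+-suc c s) ⟩
      H (suc (c + s))        ≡⟨ cong H (punchIn-above (m≤m+n c s)) ⟨
      H (punchIn c (c + s))  ≡⟨ H-punchIn (<-≤-trans (+-monoʳ-< c s<r) c+r≤n) ⟩
      punchIn c (g (c + s))  ≡⟨ punchIn-above (middle-≥ s<r) ⟩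
      suc (g (c + s))        ∎
      where open ≡-Reasoning

    first-block : ∀ {j} → j < c → isRL j ≡ false
    first-block {j} j<c = dec-false (rlMax? N H j) λ rl →
      <⇒≱ (rl (s≤s (m≤n⇒m≤1+n c≤n)) j<c)
          (subst (H j ≤_) (sym H-c) (m≤n⇒m≤1+n (H≤n (<-≤-trans j<c (m≤n⇒m≤1+n (m≤n⇒m≤1+n c≤n))) (<⇒≢ j<c))))

    position-c : isRL (c + 0) ≡ true
    position-c = dec-true (rlMax? N H (c + 0)) λ {i} i<N c+0<i →
      subst (H i <_) (sym (trans (cong H (+-identityʳ c)) H-c))
            (s≤s (H≤n i<N (<⇒≢ (subst (_< i) (+-identityʳ c) c+0<i) ∘ sym)))

    after-middle : ∀ {t i′} → t < r → RLMax r (middle c g) t → c + t < i′ → i′ < n → g i′ < g (c + t)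
    after-middle {t} {i′} t<r rl c+t<i′ i′<n with i′ <? c + r
    ... | no  i′≮c+r = <-≤-trans (last→bottom (≮⇒≥ i′≮c+r) i′<n) (middle-≥ t<r)
    ... | yes i′<c+r with s , refl ← ≤-split (≤-trans (m≤m+n c t) (<⇒≤ c+t<i′)) =
      ∸-cancelʳ-<′ (proj₁ (middle→middle (m≤m+n c s) i′<c+r)) (middle-≥ t<r)
        (rl (+-cancelˡ-< c s r i′<c+r) (+-cancelˡ-< c t s c+t<i′))
      where
      ∸-cancelʳ-<′ : ∀ {a b} → c ≤ a → c ≤ b → a ∸ c < b ∸ c → a < b
      ∸-cancelʳ-<′ c≤a c≤b lt = subst₂ _<_ (m∸n+n≡m c≤a) (m∸n+n≡m c≤b) (+-monoˡ-< c lt)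

    middle-block : ∀ {t} → t < r → isRL (c + suc t) ≡ does (rlMax? r (middle c g) t)
    middle-block {t} t<r = does-⇔ (mk⇔ to from) (rlMax? N H (c + suc t)) (rlMax? r (middle c g) t)
      where
      to : RLMax N H (c + suc t) → RLMax r (middle c g) t
      to rl {s} s<r t<s =
        ∸-monoˡ-< (s<s⁻¹ (subst₂ _<_ (H-middle s<r) (H-middle t<r) (rl c+1+s<N (+-monoʳ-< c (s<s t<s)))))
                  (middle-≥ s<r)
        where c+1+s<N = subst (_< N) (sym (+-suc c s))
                              (s<s (<-trans (<-≤-trans (+-monoʳ-< c s<r) c+r≤n) (n<1+n n)))
      from : RLMax r (middle c g) t → RLMax N H (c + suc t)
      from rl {i} i<N c+1+t<i with topView c≤n i<N
      ... | at-c    = ⊥-elim (<⇒≱ c+1+t<i (m≤m+n c (suc t)))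
      ... | at-last = subst₂ _<_ (sym H-last) (sym (H-middle t<r)) (s≤s (middle-≥ t<r))
      ... | at-punchIn {i′} i′<n =
        subst₂ _<_ (sym (H-punchIn i′<n)) (trans (punchIn-above (middle-≥ t<r)) (sym (H-middle t<r)))
               (punchIn-mono-< c (after-middle t<r rl c+t<i′ i′<n))
        where c+t<i′ = s<s⁻¹ (<-≤-trans (subst (_< punchIn c i′) (+-suc c t) c+1+t<i) (punchIn-≤ c (n<1+n i′)))

    last-block : ∀ {u} → u < c → isRL (c + suc (r + u)) ≡ false
    last-block {u} u<c = dec-false (rlMax? N H _) λ rl →
      <-asym (subst₂ _<_ H-last H-pos (rl (n<1+n (suc n)) (subst (_< suc n) (sym pos≡) (s<s c+r+u<n)))) gc+r+u<c
      where
      pos≡ : c + suc (r + u) ≡ suc (c + r + u)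
      pos≡ = trans (+-suc c (r + u)) (cong suc (sym (+-assoc c r u)))
      c+r+u<n = subst (c + r + u <_) (sym n≡) (+-monoʳ-< (c + r) u<c)
      gc+r+u<c = proj₂ shell u<c
      H-pos : H (c + suc (r + u)) ≡ g (c + r + u)
      H-pos = begin
        H (c + suc (r + u))        ≡⟨ cong H pos≡ ⟩
        H (suc (c + r + u))        ≡⟨ cong H (punchIn-above (≤-trans (m≤m+n c r) (m≤m+n (c + r) u))) ⟨
        H (punchIn c (c + r + u))  ≡⟨ H-punchIn c+r+u<n ⟩
        punchIn c (g (c + r + u))  ≡⟨ punchIn-below gc+r+u<c ⟩
        g (c + r + u)              ∎
        where open ≡-Reasoning

    position-last : isRL (c + suc (r + (c + 0))) ≡ true
    position-last = subst (λ j → isRL j ≡ true) (sym end≡) (dec-true (rlMax? N H (suc n)) (RLMax-last {suc n} {H}))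
      where
      end≡ : c + suc (r + (c + 0)) ≡ suc n
      end≡ = trans (cong (λ x → c + suc (r + x)) (+-identityʳ c))
                   (trans (+-suc c (r + c)) (cong suc (trans (sym (+-assoc c r c)) (sym n≡))))

  #RLMax-insertTop : #RLMax N H ≡ 2 + #RLMax r (middle c g)
  #RLMax-insertTop = begin
    count N isRL
      ≡⟨ cong (λ x → count x isRL) N≡ ⟩
    count (c + suc (r + (c + 1))) isRL
      ≡⟨ count-+ c _ isRL ⟩
    count c isRL + count (suc (r + (c + 1))) (isRL ∘ (c +_))
      ≡⟨ cong₂ (λ x b → x + ((if b then 1 else 0) + count (r + (c + 1)) (λ t → isRL (c + suc t))))
               (count-none c first-block) position-c ⟩
    suc (count (r + (c + 1)) (λ t → isRL (c + suc t)))
      ≡⟨ cong suc (count-+ r (c + 1) _) ⟩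
    suc (count r (λ t → isRL (c + suc t)) + count (c + 1) (λ u → isRL (c + suc (r + u))))
      ≡⟨ cong suc (cong₂ _+_ (count-cong r middle-block) (count-+ c 1 _)) ⟩
    suc (#RLMax r (middle c g) + (count c (λ u → isRL (c + suc (r + u)))
        + count 1 (λ u → isRL (c + suc (r + (c + u))))))
      ≡⟨ cong (λ x → suc (#RLMax r (middle c g) + x))
              (cong₂ _+_ (count-none c last-block)
                         (count-one {λ u → isRL (c + suc (r + (c + u)))} position-last)) ⟩
    suc (#RLMax r (middle c g) + 1)
      ≡⟨ cong suc (+-comm _ 1) ⟩
    2 + #RLMax r (middle c g)
      ∎
    where
    open ≡-Reasoning
    N≡ : N ≡ c + suc (r + (c + 1))
    N≡ = trans (cong (suc ∘ suc) n≡) (rearrange c r)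
      where rearrange : ∀ c r → suc (suc (c + r + c)) ≡ c + suc (r + (c + 1))
            rearrange = solve-∀

module DeleteTop {n f} (π : Is132Inv (suc (suc n)) f) (moved : f (suc n) ≢ suc n) where

  private
    N = suc (suc n)
    m = f (suc n)
    D = deleteTop n f

    1+n<N = n<1+n (suc n)

    m<1+n : m < suc n
    m<1+n = TopCycle.m<M π moved

  m≤n : m ≤ n
  m≤n = s≤s⁻¹ m<1+n

  private

    m<N = m<n⇒m<1+n m<1+n

    fm≡1+n : f m ≡ suc n
    fm≡1+n = involutive π 1+n<N

    punchIn<1+n : ∀ {i} → i < n → punchIn m i < suc n
    punchIn<1+n i<n = s≤s (punchIn-≤ m i<n)

    punchIn<N : ∀ {i} → i < n → punchIn m i < N
    punchIn<N i<n = m<n⇒m<1+n (punchIn<1+n i<n)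

    f-punchIn≢m : ∀ {i} → i < n → f (punchIn m i) ≢ m
    f-punchIn≢m i<n eq = <⇒≢ (punchIn<1+n i<n) (injective π (punchIn<N i<n) 1+n<N eq)

    f-punchIn<1+n : ∀ {i} → i < n → f (punchIn m i) < suc n
    f-punchIn<1+n i<n = ≤∧≢⇒< (s≤s⁻¹ (bounded π (punchIn<N i<n)))
      λ eq → punchIn≢ m _ (injective π (punchIn<N i<n) m<N (trans eq (sym fm≡1+n)))

  is132Inv : Is132Inv n D
  is132Inv = Is132Inv-restrict π (punchIn m) (punchOut m) (punchIn-mono-< m) punchIn<N (punchOut-punchIn m)
    λ i<n → punchOut-< m≤n (f-punchIn<1+n i<n) (f-punchIn≢m i<n) , punchIn-punchOut (f-punchIn≢m i<n)

  insertTop-deleteTop : insertTop m n D ≈[ N ] f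
  insertTop-deleteTop p<N with topView m≤n p<N
  ... | at-c           = trans (insertTop-c {m} {n} {D}) (sym fm≡1+n)
  ... | at-last        = insertTop-last {m} {n} {D} m≤n
  ... | at-punchIn p<n = trans (insertTop-punchIn {m} {n} {D} p<n) (punchIn-punchOut (f-punchIn≢m p<n))

  shell : Σ ℕ λ s → n ≡ m + s + m × Shell m s D
  shell = s , n≡ , top , bottom
    where
    open TopCycle π moved using (s)
    N≡ = proj₁ (TopCycle.shell π moved)
    shell′ = proj₂ (TopCycle.shell π moved)
    n≡ : n ≡ m + s + m
    n≡ = suc-injective (suc-injective (trans N≡ (rearrange m s)))
      where rearrange : ∀ m s → suc m + s + suc m ≡ suc (suc (m + s + m))
            rearrange = solve-∀
    top : ∀ {i} → i < m → m + s ≤ D i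
    top {i} i<m = subst (m + s ≤_) (sym Di≡) (<⇒≤pred fi≥)
      where
      fi≥ = proj₁ shell′ (m<n⇒m<1+n i<m)
      Di≡ : D i ≡ pred (f i)
      Di≡ = trans (cong (punchOut m ∘ f) (punchIn-below i<m)) (punchOut-above (<-≤-trans (m≤m+n (suc m) s) fi≥))
    bottom : ∀ {u} → u < m → D (m + s + u) < m
    bottom {u} u<m rewrite punchIn-above {m} {m + s + u} (≤-trans (m≤m+n m s) (m≤m+n (m + s) u)) =
      subst (_< m) (sym (punchOut-below f<m)) f<m
      where
      m+s+u<n = subst (m + s + u <_) (sym n≡) (+-monoʳ-< (m + s) u<m)
      f<m : f (suc (m + s + u)) < m
      f<m = ≤∧≢⇒< (s≤s⁻¹ (proj₂ shell′ (m<n⇒m<1+n u<m)))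
              (f-punchIn≢m m+s+u<n ∘ trans (cong f (punchIn-above (≤-trans (m≤m+n m s) (m≤m+n (m + s) u)))))

-- The outer part and the middle of a shell

-- skip c r embeds [0, c + c) into [0, c + r + c), leaving out the middle block [c, c + r)
skip : ℕ → ℕ → ℕ → ℕ
skip zero    r x       = x + r
skip (suc c) r zero    = zero
skip (suc c) r (suc x) = suc (skip c r x)

unskip : ℕ → ℕ → ℕ → ℕ
unskip zero    r v       = v ∸ r
unskip (suc c) r zero    = zero
unskip (suc c) r (suc v) = suc (unskip c r v)

module _ {r : ℕ} where

  skip-below : ∀ {c x} → x < c → skip c r x ≡ x
  skip-below {suc c} {zero}  _   = refl
  skip-below {suc c} {suc x} x<c = cong suc (skip-below (s<s⁻¹ x<c))

  skip-above : ∀ {c x} → c ≤ x → skip c r x ≡ x + r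
  skip-above {zero}          _   = refl
  skip-above {suc c} {suc x} c≤x = cong suc (skip-above (s≤s⁻¹ c≤x))

  unskip-below : ∀ {c v} → v < c → unskip c r v ≡ v
  unskip-below {suc c} {zero}  _   = refl
  unskip-below {suc c} {suc v} v<c = cong suc (unskip-below (s<s⁻¹ v<c))

  unskip-above : ∀ {c v} → c + r ≤ v → unskip c r v ≡ v ∸ r
  unskip-above {zero}          _     = refl
  unskip-above {suc c} {suc v} c+r≤v =
    trans (cong suc (unskip-above (s≤s⁻¹ c+r≤v))) (sym (+-∸-assoc 1 (≤-trans (m≤n+m r c) (s≤s⁻¹ c+r≤v))))

  skip-mono-< : ∀ c {x y} → x < y → skip c r x < skip c r y
  skip-mono-< zero                    x<y = +-monoˡ-< r x<y
  skip-mono-< (suc c) {zero}  {suc y} _   = z<s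
  skip-mono-< (suc c) {suc x} {suc y} x<y = s<s (skip-mono-< c (s<s⁻¹ x<y))

  skip-cancel-< : ∀ c {x y} → skip c r x < skip c r y → x < y
  skip-cancel-< c {x} {y} lt with <-cmp x y
  ... | tri< x<y _ _ = x<y
  ... | tri≈ _ refl _ = ⊥-elim (<-irrefl refl lt)
  ... | tri> _ _ y<x = ⊥-elim (<-asym lt (skip-mono-< c y<x))

  unskip-skip : ∀ c x → unskip c r (skip c r x) ≡ x
  unskip-skip zero    x       = m+n∸n≡m x r
  unskip-skip (suc c) zero    = refl
  unskip-skip (suc c) (suc x) = cong suc (unskip-skip c x)

  skip-unskip : ∀ {c v} → v < c ⊎ c + r ≤ v → skip c r (unskip c r v) ≡ v
  skip-unskip {c} (inj₁ v<c) = trans (cong (skip c r) (unskip-below v<c)) (skip-below v<c)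
  skip-unskip {c} {v} (inj₂ c+r≤v) = begin
    skip c r (unskip c r v) ≡⟨ cong (skip c r) (unskip-above c+r≤v) ⟩
    skip c r (v ∸ r)        ≡⟨ skip-above (subst (_≤ v ∸ r) (m+n∸n≡m c r) (∸-monoˡ-≤ r c+r≤v)) ⟩
    v ∸ r + r               ≡⟨ m∸n+n≡m (≤-trans (m≤n+m r c) c+r≤v) ⟩
    v                       ∎
    where open ≡-Reasoning

  unskip-< : ∀ {c v} → v < c + r + c → v < c ⊎ c + r ≤ v → unskip c r v < c + c
  unskip-< {c} {v} v<n (inj₁ v<c)   = subst (_< c + c) (sym (unskip-below v<c)) (<-≤-trans v<c (m≤m+n c c))
  unskip-< {c} {v} v<n (inj₂ c+r≤v) = subst₂ _<_ (sym (unskip-above {c} c+r≤v)) n∸r≡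
    (∸-monoˡ-< v<n (≤-trans (m≤n+m r c) c+r≤v))
    where n∸r≡ = trans (cong (_∸ r) (xy∙z≈xz∙y c r c)) (m+n∸n≡m (c + c) r)

  skip-< : ∀ c {x} → x < c + c → skip c r x < c + r + c
  skip-< c {x} x<c+c with x <? c
  ... | yes x<c = subst (_< c + r + c) (sym (skip-below x<c))
                  (<-≤-trans x<c (≤-trans (m≤m+n c r) (m≤m+n (c + r) c)))
  ... | no  x≮c = subst₂ _<_ (sym (skip-above (≮⇒≥ x≮c))) (xy∙z≈xz∙y c c r) (+-monoˡ-< r x<c+c)

outer : ℕ → ℕ → (ℕ → ℕ) → ℕ → ℕ
outer c r g = unskip c r ∘ g ∘ skip c r

glue : ℕ → ℕ → (ℕ → ℕ) → (ℕ → ℕ) → ℕ → ℕ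
glue c r S μ i =
  if does (i <? c) then skip c r (S i) else if does (i <? c + r) then c + μ (i ∸ c) else skip c r (S (i ∸ r))

data BlockView (c r : ℕ) : ℕ → Set where
  in-first  : ∀ {i} → i < c → BlockView c r i
  in-middle : ∀ {t} → t < r → BlockView c r (c + t)
  in-last   : ∀ {u} → u < c → BlockView c r (c + r + u)

blockView : ∀ {c r p} → p < c + r + c → BlockView c r p
blockView {c} {r} {p} p<n with p <? c | p <? c + r
... | yes p<c | _ = in-first p<c
... | no p≮c | yes p<c+r with t , refl ← ≤-split (≮⇒≥ p≮c) = in-middle (+-cancelˡ-< c t r p<c+r)
... | no _   | no p≮c+r  with u , refl ← ≤-split (≮⇒≥ p≮c+r) = in-last (+-cancelˡ-< (c + r) u c p<n)

module _ {c r : ℕ} {S μ : ℕ → ℕ} where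

  glue-first : ∀ {i} → i < c → glue c r S μ i ≡ skip c r (S i)
  glue-first {i} i<c rewrite dec-true (i <? c) i<c = refl

  glue-middle : ∀ {t} → t < r → glue c r S μ (c + t) ≡ c + μ t
  glue-middle {t} t<r
    rewrite dec-false (c + t <? c) (≤⇒≯ (m≤m+n c t))
          | dec-true (c + t <? c + r) (+-monoʳ-< c t<r) | m+n∸m≡n c t = refl

  glue-last : ∀ u → glue c r S μ (c + r + u) ≡ skip c r (S (c + u))
  glue-last u
    rewrite dec-false (c + r + u <? c) (≤⇒≯ (≤-trans (m≤m+n c r) (m≤m+n (c + r) u)))
          | dec-false (c + r + u <? c + r) (≤⇒≯ (m≤m+n (c + r) u))
          | xy∙z≈xz∙y c r u | m+n∸n≡m (c + u) r = refl

  glue-skip : ∀ {x} → x < c + c → glue c r S μ (skip c r x) ≡ skip c r (S x)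
  glue-skip {x} x<c+c with x <? c
  ... | yes x<c = trans (cong (glue c r S μ) (skip-below x<c)) (glue-first x<c)
  ... | no  x≮c with u , refl ← ≤-split (≮⇒≥ x≮c) =
    trans (cong (glue c r S μ) (trans (skip-above (m≤m+n c u)) (xy∙z≈xz∙y c u r))) (glue-last u)

data GlueView (c r : ℕ) : ℕ → Set where
  outer-pos  : ∀ {x} → x < c + c → GlueView c r (skip c r x)
  middle-pos : ∀ {t} → t < r → GlueView c r (c + t)

glueView : ∀ {c r p} → p < c + r + c → GlueView c r p
glueView {c} {r} p<n with blockView p<n
... | in-first i<c  = subst (GlueView c r) (skip-below i<c) (outer-pos (<-≤-trans i<c (m≤m+n c c)))
... | in-middle t<r = middle-pos t<r
... | in-last {u} u<c =
  subst (GlueView c r) (trans (skip-above (m≤m+n c u)) (xy∙z≈xz∙y c u r)) (outer-pos (+-monoʳ-< c u<c))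

module Decompose {n c r g} (n≡ : n ≡ c + r + c) (π : Is132Inv n g) (shell : Shell c r g) where
  open ShellFacts n≡ π shell

  middle-is132Inv : Is132Inv r (middle c g)
  middle-is132Inv = Is132Inv-restrict π (c +_) (_∸ c) (+-monoʳ-< c)
                    (λ t<r → <-≤-trans (+-monoʳ-< c t<r) c+r≤n) (m+n∸m≡n c)
    λ {t} t<r → let c≤gt , gt<c+r = middle→middle (m≤m+n c t) (+-monoʳ-< c t<r) in
      subst (g (c + t) ∸ c <_) (m+n∸m≡n c r) (∸-monoˡ-< gt<c+r c≤gt) , m+[n∸m]≡n c≤gt

  private
    skip<n : ∀ {x} → x < c + c → skip c r x < n
    skip<n x<c+c = subst (_ <_) (sym n≡) (skip-< c x<c+c)

    outer-values : ∀ {x} → x < c + c → g (skip c r x) < c ⊎ c + r ≤ g (skip c r x)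
    outer-values {x} x<c+c with x <? c
    ... | yes x<c = inj₂ (subst (λ p → c + r ≤ g p) (sym (skip-below x<c)) (first→top x<c))
    ... | no  x≮c = inj₁ (last→bottom (subst (c + r ≤_) (sym (skip-above (≮⇒≥ x≮c))) (+-monoˡ-≤ r (≮⇒≥ x≮c)))
                    (skip<n x<c+c))

    skip-outer : ∀ {x} → x < c + c → skip c r (outer c r g x) ≡ g (skip c r x)
    skip-outer x<c+c = skip-unskip (outer-values x<c+c)

  outer-is132Inv : Is132Inv (c + c) (outer c r g)
  outer-is132Inv = Is132Inv-restrict π (skip c r) (unskip c r) (skip-mono-< c) skip<n (unskip-skip c)
    λ x<c+c → unskip-< (subst (_ <_) n≡ (bounded π (skip<n x<c+c))) (outer-values x<c+c) , skip-outer x<c+c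

  outer-shell : Shell c 0 (outer c r g)
  outer-shell = first , last
    where
    first : ∀ {i} → i < c → c + 0 ≤ outer c r g i
    first {i} i<c = begin
      c + 0            ≡⟨ +-identityʳ c ⟩
      c                ≡⟨ m+n∸n≡m c r ⟨
      c + r ∸ r        ≤⟨ ∸-monoˡ-≤ r (first→top i<c) ⟩
      g i ∸ r          ≡⟨ unskip-above {r} {c} (first→top i<c) ⟨
      unskip c r (g i) ≡⟨ cong (unskip c r ∘ g) (skip-below i<c) ⟨
      outer c r g i    ∎
      where open ≤-Reasoning
    last : ∀ {u} → u < c → outer c r g (c + 0 + u) < c
    last {u} u<c = subst (_< c) (sym (trans (cong (unskip c r ∘ g) skip≡) (unskip-below (proj₂ shell u<c))))
                         (proj₂ shell u<c)
      where skip≡ : skip c r (c + 0 + u) ≡ c + r + u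
            skip≡ = trans (skip-above (≤-trans (m≤m+n c 0) (m≤m+n (c + 0) u)))
                          (trans (cong (λ x → x + u + r) (+-identityʳ c)) (xy∙z≈xz∙y c u r))

  glue-outer-middle : glue c r (outer c r g) (middle c g) ≈[ n ] g
  glue-outer-middle {p} p<n with glueView {c} {r} (subst (p <_) n≡ p<n)
  ... | outer-pos x<c+c = trans (glue-skip {c} {r} {outer c r g} {middle c g} x<c+c) (skip-outer x<c+c)
  ... | middle-pos t<r  = trans (glue-middle {c} {r} {outer c r g} {middle c g} t<r)
                        (m+[n∸m]≡n (proj₁ (middle→middle (m≤m+n c _) (+-monoʳ-< c t<r))))

module Glue {c r S μ} (σ : Is132Inv (c + c) S) (σ-shell : Shell c 0 S) (ρ : Is132Inv r μ) where

  private
    n = c + r + c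
    G = glue c r S μ

    G-first : ∀ {i} → i < c → G i ≡ skip c r (S i)
    G-first = glue-first {c} {r} {S} {μ}

    G-middle : ∀ {t} → t < r → G (c + t) ≡ c + μ t
    G-middle = glue-middle {c} {r} {S} {μ}

    G-last : ∀ u → G (c + r + u) ≡ skip c r (S (c + u))
    G-last = glue-last {c} {r} {S} {μ}

    G-skip : ∀ {x} → x < c + c → G (skip c r x) ≡ skip c r (S x)
    G-skip = glue-skip {c} {r} {S} {μ}

    S-first : ∀ {i} → i < c → c ≤ S i
    S-first i<c = ≤-trans (m≤m+n c 0) (proj₁ σ-shell i<c)

    S-last : ∀ {u} → u < c → S (c + u) < c
    S-last {u} u<c = subst (λ p → S (p + u) < c) (+-identityʳ c) (proj₂ σ-shell u<c)

    first→top : ∀ {i} → i < c → c + r ≤ G i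
    first→top i<c = subst (c + r ≤_) (sym (trans (G-first i<c) (skip-above (S-first i<c))))
                    (+-monoˡ-≤ r (S-first i<c))

    last→bottom : ∀ {u} → u < c → G (c + r + u) < c
    last→bottom {u} u<c = subst (_< c) (sym (trans (G-last u) (skip-below (S-last u<c)))) (S-last u<c)

    middle-≥ : ∀ {t} → t < r → c ≤ G (c + t)
    middle-≥ {t} t<r = subst (c ≤_) (sym (G-middle t<r)) (m≤m+n c (μ t))

    middle-< : ∀ {t} → t < r → G (c + t) < c + r
    middle-< t<r = subst (_< c + r) (sym (G-middle t<r)) (+-monoʳ-< c (bounded ρ t<r))

  shell : Shell c r G
  shell = first→top , last→bottom

  middle-glue : middle c G ≈[ r ] μ
  middle-glue {t} t<r = trans (cong (_∸ c) (G-middle t<r)) (m+n∸m≡n c (μ t))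

  outer-glue : outer c r G ≈[ c + c ] S
  outer-glue {x} x<c+c = trans (cong (unskip c r) (G-skip x<c+c)) (unskip-skip c (S x))

  private
    bounded′ : Bounded n G
    bounded′ p<n with glueView {c} {r} p<n
    ... | outer-pos x<c+c = subst (_< n) (sym (G-skip x<c+c)) (skip-< c (bounded σ x<c+c))
    ... | middle-pos t<r  = <-≤-trans (middle-< t<r) (m≤m+n (c + r) c)

    involutive′ : Involutive n G
    involutive′ p<n with glueView {c} {r} p<n
    ... | outer-pos {x} x<c+c = begin
      G (G (skip c r x))   ≡⟨ cong G (G-skip x<c+c) ⟩
      G (skip c r (S x))   ≡⟨ G-skip (bounded σ x<c+c) ⟩
      skip c r (S (S x))   ≡⟨ cong (skip c r) (involutive σ x<c+c) ⟩
      skip c r x           ∎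
      where open ≡-Reasoning
    ... | middle-pos {t} t<r = begin
      G (G (c + t))        ≡⟨ cong G (G-middle t<r) ⟩
      G (c + μ t)          ≡⟨ G-middle (bounded ρ t<r) ⟩
      c + μ (μ t)          ≡⟨ cong (c +_) (involutive ρ t<r) ⟩
      c + t                ∎
      where open ≡-Reasoning

    no132′ : No132 n G
    no132′ {i} {j} {k} i<j j<k k<n Gi<Gk Gk<Gj with blockView {c} {r} k<n
    ... | in-first k<c = no132 σ i<j j<k (<-≤-trans k<c (m≤m+n c c))
      (skip-cancel-< c (subst₂ _<_ (G-first i<c) (G-first k<c) Gi<Gk))
      (skip-cancel-< c (subst₂ _<_ (G-first k<c) (G-first j<c) Gk<Gj))
      where j<c = <-trans j<k k<c
            i<c = <-trans i<j j<c
    ... | in-middle {t} t<r with blockView {c} {r} (<-trans i<j (<-trans j<k k<n))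
    ...   | in-first i<c = <⇒≱ Gi<Gk (≤-trans (<⇒≤ (middle-< t<r)) (first→top i<c))
    ...   | in-last {u} _ = <⇒≱ (<-trans i<j j<k) (≤-trans (<⇒≤ (+-monoʳ-< c t<r)) (m≤m+n (c + r) u))
    ...   | in-middle {s} s<r with blockView {c} {r} (<-trans j<k k<n)
    ...     | in-first j<c = <⇒≱ i<j (≤-trans (<⇒≤ j<c) (m≤m+n c s))
    ...     | in-last {u} _ = <⇒≱ j<k (≤-trans (<⇒≤ (+-monoʳ-< c t<r)) (m≤m+n (c + r) u))
    ...     | in-middle {s′} s′<r = no132 ρ (+-cancelˡ-< c s s′ i<j) (+-cancelˡ-< c s′ t j<k) t<r
      (+-cancelˡ-< c _ _ (subst₂ _<_ (G-middle s<r) (G-middle t<r) Gi<Gk))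
      (+-cancelˡ-< c _ _ (subst₂ _<_ (G-middle t<r) (G-middle s′<r) Gk<Gj))
    no132′ {i} {j} {k} i<j j<k k<n Gi<Gk Gk<Gj | in-last {u} u<c
      with blockView {c} {r} (<-trans i<j (<-trans j<k k<n))
    ...   | in-first i<c  = <⇒≱ Gi<Gk (≤-trans (<⇒≤ (last→bottom u<c)) (≤-trans (m≤m+n c r) (first→top i<c)))
    ...   | in-middle s<r = <⇒≱ Gi<Gk (≤-trans (<⇒≤ (last→bottom u<c)) (middle-≥ s<r))
    ...   | in-last {u′} _ with blockView {c} {r} (<-trans j<k k<n)
    ...     | in-first j<c = <⇒≱ i<j (≤-trans (<⇒≤ j<c) (≤-trans (m≤m+n c r) (m≤m+n (c + r) u′)))
    ...     | in-middle {t} t<r = <⇒≱ i<j (≤-trans (<⇒≤ (+-monoʳ-< c t<r)) (m≤m+n (c + r) u′))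
    ...     | in-last {u″} _ = no132 σ
      (+-monoʳ-< c (+-cancelˡ-< (c + r) u′ u″ i<j)) (+-monoʳ-< c (+-cancelˡ-< (c + r) u″ u j<k)) (+-monoʳ-< c u<c)
      (skip-cancel-< c (subst₂ _<_ (G-last u′) (G-last u) Gi<Gk))
      (skip-cancel-< c (subst₂ _<_ (G-last u) (G-last u″) Gk<Gj))

  is132Inv : Is132Inv n G
  is132Inv = record { bounded = bounded′ ; involutive = involutive′ ; no132 = no132′ }

outer-cong : ∀ {c r f f′} → f ≈[ c + r + c ] f′ → outer c r f ≈[ c + c ] outer c r f′
outer-cong {c} {r} f≈f′ x<c+c = cong (unskip c r) (f≈f′ (skip-< c x<c+c))

middle-cong : ∀ {c r f f′} → f ≈[ c + r + c ] f′ → middle c f ≈[ r ] middle c f′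
middle-cong {c} {r} f≈f′ t<r = cong (_∸ c) (f≈f′ (<-≤-trans (+-monoʳ-< c t<r) (m≤m+n (c + r) c)))

glue-cong : ∀ {c r S S′ μ μ′} → S ≈[ c + c ] S′ → μ ≈[ r ] μ′ → glue c r S μ ≈[ c + r + c ] glue c r S′ μ′
glue-cong {c} {r} {S} {S′} {μ} {μ′} S≈S′ μ≈μ′ p<n with glueView {c} {r} p<n
... | outer-pos x<c+c = trans (glue-skip {c} {r} {S} {μ} x<c+c)
                          (trans (cong (skip c r) (S≈S′ x<c+c)) (sym (glue-skip {c} {r} {S′} {μ′} x<c+c)))
... | middle-pos t<r  = trans (glue-middle {c} {r} {S} {μ} t<r)
                          (trans (cong (c +_) (μ≈μ′ t<r)) (sym (glue-middle {c} {r} {S′} {μ′} t<r)))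


-- The widest shell

Shell-compose : ∀ {n c r d s g} → n ≡ c + r + c → Is132Inv n g → Shell c r g →
                r ≡ d + s + d → Shell d s (middle c g) → n ≡ (c + d) + s + (c + d) × Shell (c + d) s g
Shell-compose {n} {c} {r} {d} {s} {g} n≡ π shell r≡ (inner-top , inner-bottom) = n≡′ , top , bottom
  where
  open ShellFacts n≡ π shell
  n≡′ : n ≡ (c + d) + s + (c + d)
  n≡′ = trans n≡ (trans (cong (λ x → c + x + c) r≡) (rearrange c d s))
    where rearrange : ∀ c d s → c + (d + s + d) + c ≡ c + d + s + (c + d)
          rearrange = solve-∀
  top : ∀ {i} → i < c + d → c + d + s ≤ g i
  top {i} i<c+d with i <? c
  ... | yes i<c = ≤-trans (subst (c + d + s ≤_) (cong (c +_) (sym r≡)) c+d+s≤c+[d+s+d]) (first→top i<c)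
    where c+d+s≤c+[d+s+d] = subst (_≤ c + (d + s + d)) (sym (+-assoc c d s)) (+-monoʳ-≤ c (m≤m+n (d + s) d))
  ... | no  i≮c with t , refl ← ≤-split (≮⇒≥ i≮c) = begin
    c + d + s               ≡⟨ +-assoc c d s ⟩
    c + (d + s)             ≤⟨ +-monoʳ-≤ c (inner-top t<d) ⟩
    c + (g (c + t) ∸ c)     ≡⟨ m+[n∸m]≡n (proj₁ (middle→middle (m≤m+n c t) (+-monoʳ-< c t<r))) ⟩
    g (c + t)               ∎
    where
    open ≤-Reasoning
    t<d = +-cancelˡ-< c t d i<c+d
    t<r = subst (t <_) (sym r≡) (<-≤-trans t<d (≤-trans (m≤m+n d s) (m≤m+n (d + s) d)))
  bottom : ∀ {u} → u < c + d → g (c + d + s + u) < c + d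
  bottom {u} u<c+d with u <? d
  ... | yes u<d = ≤-<-trans (m≤n+m∸n (g (c + d + s + u)) c)
                    (+-monoʳ-< c (subst (λ p → g p ∸ c < d) (rearrange c d s u) (inner-bottom u<d)))
    where rearrange : ∀ c d s u → c + (d + s + u) ≡ c + d + s + u
          rearrange = solve-∀
  ... | no  u≮d with u′ , refl ← ≤-split (≮⇒≥ u≮d) =
    <-≤-trans (subst (λ p → g p < c) (trans (cong (λ x → c + x + u′) r≡) (rearrange c d s u′)) (proj₂ shell u′<c))
              (m≤m+n c d)
    where
    u′<c = +-cancelˡ-< d u′ c (subst (d + u′ <_) (+-comm c d) u<c+d)
    rearrange : ∀ c d s u′ → c + (d + s + d) + u′ ≡ c + d + s + (d + u′)
    rearrange = solve-∀

Shell-middle : ∀ {n c r d r′ g} → n ≡ c + r + c → n ≡ (c + d) + r′ + (c + d) → Shell (c + d) r′ g →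
               r ≡ d + r′ + d × Shell d r′ (middle c g)
Shell-middle {n} {c} {r} {d} {r′} {g} n≡ n≡′ (top , bottom) = r≡ , top′ , bottom′
  where
  r≡ : r ≡ d + r′ + d
  r≡ = middle-width-unique {c} (trans (sym n≡) (trans n≡′ (rearrange c d r′)))
    where rearrange : ∀ c d r′ → c + d + r′ + (c + d) ≡ c + (d + r′ + d) + c
          rearrange = solve-∀
  top′ : ∀ {t} → t < d → d + r′ ≤ middle c g t
  top′ {t} t<d = subst (_≤ middle c g t) (trans (cong (_∸ c) (+-assoc c d r′)) (m+n∸m≡n c (d + r′)))
                   (∸-monoˡ-≤ c (top (+-monoʳ-< c t<d)))
  bottom′ : ∀ {u} → u < d → middle c g (d + r′ + u) < d
  bottom′ {u} u<d = m<n+o⇒m∸n<o _ c {{>-nonZero (≤-<-trans z≤n u<d)}}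
    (subst (λ p → g p < c + d) (rearrange c d r′ u) (bottom (<-≤-trans u<d (m≤n+m d c))))
    where rearrange : ∀ c d r′ u → c + d + r′ + u ≡ c + (d + r′ + u)
          rearrange = solve-∀

shell⇒2≤#RLMax : ∀ {n c r f} → Is132Inv n f → n ≡ c + r + c → 0 < c → Shell c r f → 2 ≤ #RLMax n f
shell⇒2≤#RLMax {c = suc c′} {r} {f} π n≡ _ (_ , bottom) with refl ← trans n≡ (+-suc (suc c′ + r) c′) =
  LastEntry.2≤#RLMax-moved π λ fM≡M → <⇒≱ (subst (_< suc c′) fM≡M (bottom (n<1+n c′))) (s≤s (m≤n+m c′ (c′ + r)))

no-shell⇒#RLMax≤1 : ∀ {n f} → Is132Inv n f → (∀ {c r} → 0 < c → n ≡ c + r + c → ¬ Shell c r f) → #RLMax n f ≤ 1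
no-shell⇒#RLMax≤1 {zero}      π no-shell = z≤n
no-shell⇒#RLMax≤1 {suc M} {f} π no-shell with f M ≟ M
... | yes fixed = ≤-reflexive (LastEntry.#RLMax-fixed π fixed)
... | no  moved = ⊥-elim (no-shell z<s (proj₁ (TopCycle.shell π moved)) (proj₂ (TopCycle.shell π moved)))

module Greatest {P : ℕ → Set} (P? : ∀ c → Dec (P c)) (P0 : P 0) where

  greatest : ℕ → ℕ
  greatest zero    = 0
  greatest (suc k) with P? (suc k)
  ... | yes _ = suc k
  ... | no  _ = greatest k

  greatest-satisfies : ∀ k → P (greatest k)
  greatest-satisfies zero = P0
  greatest-satisfies (suc k) with P? (suc k)
  ... | yes p = p
  ... | no  _ = greatest-satisfies k

  greatest-≥ : ∀ k {c} → c ≤ k → P c → c ≤ greatest k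
  greatest-≥ zero    z≤n _ = z≤n
  greatest-≥ (suc k) {c} c≤1+k pc with P? (suc k) | m≤n⇒m<n∨m≡n c≤1+k
  ... | yes _  | _         = c≤1+k
  ... | no  _  | inj₁ c<1+k = greatest-≥ k (s≤s⁻¹ c<1+k) pc
  ... | no ¬p  | inj₂ refl = ⊥-elim (¬p pc)

HasShell : ℕ → (ℕ → ℕ) → ℕ → Set
HasShell n f c = ∃ λ r → n ≡ c + r + c × Shell c r f

shell? : ∀ c r f → Dec (Shell c r f)
shell? c r f = allUpTo? (λ i → c + r ≤? f i) c ×-dec allUpTo? (λ u → f (c + r + u) <? c) c

hasShell? : ∀ n f c → Dec (HasShell n f c)
hasShell? n f c with c + c ≤? n
... | no  c+c≰n = no λ (r , n≡ , _) → c+c≰n (subst (c + c ≤_) (sym n≡)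
    (subst (c + c ≤_) (xy∙z≈xz∙y c c r) (m≤m+n (c + c) r)))
... | yes c+c≤n with shell? c (n ∸ (c + c)) f
...   | yes shell = yes (_ , n≡ , shell)
  where n≡ = trans (sym (m+[n∸m]≡n c+c≤n)) (sym (xy∙z≈xz∙y c (n ∸ (c + c)) c))
...   | no ¬shell = no λ (r , n≡ , shell) → ¬shell (subst (λ r → Shell c r f) (r≡ n≡) shell)
  where r≡ : ∀ {r} → n ≡ c + r + c → r ≡ n ∸ (c + c)
        r≡ {r} n≡ = sym (trans (cong (_∸ (c + c)) (trans n≡ (xy∙z≈xz∙y c r c))) (m+n∸m≡n (c + c) r))

module WidestShell {n f} (π : Is132Inv n f) where
  open Greatest (hasShell? n f) (n , sym (+-identityʳ n) , (λ ()) , (λ ()))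

  c₀ : ℕ
  c₀ = greatest n

  widest : HasShell n f c₀
  widest = greatest-satisfies n

  r₀ = proj₁ widest
  n≡₀ = proj₁ (proj₂ widest)
  shell₀ = proj₂ (proj₂ widest)

  private
    widest-≥ : ∀ {c} → HasShell n f c → c ≤ c₀
    widest-≥ {c} has@(r , n≡ , _) = greatest-≥ n (subst (c ≤_) (sym n≡) (m≤n+m c (c + r))) has

  middle-#RLMax≤1 : #RLMax r₀ (middle c₀ f) ≤ 1
  middle-#RLMax≤1 = no-shell⇒#RLMax≤1 (Decompose.middle-is132Inv n≡₀ π shell₀) λ {d} {s} 0<d r₀≡ shell →
    let n≡′ , shell′ = Shell-compose n≡₀ π shell₀ r₀≡ shell in
    <⇒≱ (m<m+n c₀ 0<d) (widest-≥ (s , n≡′ , shell′))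

  widest-unique : ∀ {c r} → n ≡ c + r + c → Shell c r f → #RLMax r (middle c f) ≤ 1 → c ≡ c₀
  widest-unique {c} {r} n≡ shell ≤1 with m≤n⇒m<n∨m≡n (widest-≥ (r , n≡ , shell))
  ... | inj₂ c≡c₀ = c≡c₀
  ... | inj₁ c<c₀ = ⊥-elim (<⇒≱ (shell⇒2≤#RLMax (Decompose.middle-is132Inv n≡ π shell)
                    r≡ (m<n⇒0<n∸m c<c₀) middle-shell) ≤1)
    where
    c₀≡ : c₀ ≡ c + (c₀ ∸ c)
    c₀≡ = sym (m+[n∸m]≡n (<⇒≤ c<c₀))
    r≡,middle-shell = Shell-middle n≡ (subst (λ x → n ≡ x + r₀ + x) c₀≡ n≡₀)
                                      (subst (λ x → Shell x r₀ f) c₀≡ shell₀)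
    r≡ = proj₁ r≡,middle-shell
    middle-shell = proj₂ r≡,middle-shell

-- The bijection

Invs : ℕ → (ℕ → Bool) → Set
Invs n q = Σ (Inv132 n) λ p → T (q (#RLMax n ⌊ p ⌋))

Shells : ℕ → Set
Shells c = Σ (Inv132 (c + c)) λ p → True (shell? c 0 ⌊ p ⌋)

Shelled : ℕ → ℕ → (ℕ → Bool) → Set
Shelled c r q = Σ (Inv132 (c + r + c)) λ p → True (shell? c r ⌊ p ⌋) × T (q (#RLMax r (middle c ⌊ p ⌋)))

Split : ℕ → (ℕ → ℕ → Set) → Set
Split n X = Σ ℕ λ c → Σ ℕ λ r → c + r + c ≡ n × X c r

Σ-Inv132-≡ : ∀ {m} {P : Inv132 m → Set} → (∀ {p} (a b : P p) → a ≡ b) →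
             {x y : Σ (Inv132 m) P} → ⌊ proj₁ x ⌋ ≈[ m ] ⌊ proj₁ y ⌋ → x ≡ y
Σ-Inv132-≡ P-irrelevant {p , a} {p′ , b} p≈p′ with refl ← Inv132-≡ {p = p} {p′} p≈p′ =
  cong (p ,_) (P-irrelevant a b)

Invs-≡ : ∀ {n q} {x y : Invs n q} → ⌊ proj₁ x ⌋ ≈[ n ] ⌊ proj₁ y ⌋ → x ≡ y
Invs-≡ = Σ-Inv132-≡ T-irrelevant

Shells-≡ : ∀ {c} {x y : Shells c} → ⌊ proj₁ x ⌋ ≈[ c + c ] ⌊ proj₁ y ⌋ → x ≡ y
Shells-≡ = Σ-Inv132-≡ T-irrelevant

Shelled-≡ : ∀ {c r q} {x y : Shelled c r q} → ⌊ proj₁ x ⌋ ≈[ c + r + c ] ⌊ proj₁ y ⌋ → x ≡ y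
Shelled-≡ = Σ-Inv132-≡ λ (a , b) (a′ , b′) → cong₂ _,_ (T-irrelevant a a′) (T-irrelevant b b′)

toInvs : ∀ {n q} f → Is132Inv n f → T (q (#RLMax n f)) → Invs n q
toInvs {n} {q} f π rl = toInv132 n f π , subst (T ∘ q) (sym (#RLMax-cong (⌊toInv132⌋ n f π))) rl

toShells : ∀ {c} f → Is132Inv (c + c) f → Shell c 0 f → Shells c
toShells {c} f π shell =
  toInv132 (c + c) f π
  , fromWitness (Shell-resp (cong (_+ c) (sym (+-identityʳ c))) (≈-sym (⌊toInv132⌋ (c + c) f π)) shell)

toShelled : ∀ {c r q} f → Is132Inv (c + r + c) f → Shell c r f → T (q (#RLMax r (middle c f))) → Shelled c r q
toShelled {c} {r} {q} f π shell rl =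
  toInv132 (c + r + c) f π , fromWitness (Shell-resp refl (≈-sym f≈) shell)
    , subst (T ∘ q) (sym (#RLMax-cong (middle-cong {c} {r} f≈))) rl
  where f≈ = ⌊toInv132⌋ (c + r + c) f π

Shelled↔Shells×Invs : ∀ {c r q} → Shelled c r q ↔ (Shells c × Invs r q)
Shelled↔Shells×Invs {c} {r} {q} = mk↔ₛ′ to from to∘from from∘to
  where
  to : Shelled c r q → Shells c × Invs r q
  to (p , shell , rl) = toShells (outer c r ⌊ p ⌋) outer-is132Inv outer-shell
                        , toInvs {q = q} (middle c ⌊ p ⌋) middle-is132Inv rl
    where open Decompose refl (Inv132⇒Is132Inv p) (toWitness shell)

  from : Shells c × Invs r q → Shelled c r q
  from ((s , shell) , (p , rl)) = toShelled {q = q} (glue c r ⌊ s ⌋ ⌊ p ⌋) is132Inv (Glue.shell σ σ-shell ρ)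
                                            (subst (T ∘ q) (sym (#RLMax-cong middle-glue)) rl)
    where σ = Inv132⇒Is132Inv s
          σ-shell = toWitness shell
          ρ = Inv132⇒Is132Inv p
          open Glue σ σ-shell ρ using (is132Inv; middle-glue)

  to∘from : ∀ y → to (from y) ≡ y
  to∘from y@((s , shell) , (p , rl)) = cong₂ _,_
    (Shells-≡ (≈-trans (⌊toInv132⌋ (c + c) _ outer-is132Inv)
               (≈-trans (outer-cong {c} {r} G′≈G) (Glue.outer-glue σ σ-shell ρ))))
    (Invs-≡ {q = q} (≈-trans (⌊toInv132⌋ r _ middle-is132Inv)
                     (≈-trans (middle-cong {c} {r} G′≈G) (Glue.middle-glue σ σ-shell ρ))))
    where
    σ = Inv132⇒Is132Inv s
    σ-shell = toWitness shell
    ρ = Inv132⇒Is132Inv p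
    G′≈G = ⌊toInv132⌋ (c + r + c) (glue c r ⌊ s ⌋ ⌊ p ⌋) (Glue.is132Inv σ σ-shell ρ)
    open Decompose refl (Inv132⇒Is132Inv (proj₁ (from y))) (toWitness (proj₁ (proj₂ (from y))))

  from∘to : ∀ x → from (to x) ≡ x
  from∘to x@(p , shell , rl) = Shelled-≡ {q = q} (≈-trans (⌊toInv132⌋ (c + r + c) _ (Glue.is132Inv σ σ-shell ρ))
    (≈-trans (glue-cong {c} {r} (⌊toInv132⌋ (c + c) _ outer-is132Inv) (⌊toInv132⌋ r _ middle-is132Inv))
             glue-outer-middle))
    where
    open Decompose refl (Inv132⇒Is132Inv p) (toWitness shell)
    σ = Inv132⇒Is132Inv (proj₁ (proj₁ (to x)))
    σ-shell = toWitness (proj₂ (proj₁ (to x)))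
    ρ = Inv132⇒Is132Inv (proj₁ (proj₂ (to x)))

Split-cong : ∀ {n} {X Y : ℕ → ℕ → Set} → (∀ {c r} → X c r ↔ Y c r) → Split n X ↔ Split n Y
Split-cong X↔Y = Σ-↔ ↔-refl (Σ-↔ ↔-refl (↔-refl ×-↔ X↔Y))

Split-middle-suc : ∀ {n q q′} → (∀ {r} → Invs r q ↔ Invs (suc r) q′) → ¬ Invs 0 q′ →
                   Split n (λ c r → Shells c × Invs r q) ↔ Split (suc n) (λ c r → Shells c × Invs r q′)
Split-middle-suc {n} {q} {q′} per-middle empty = mk↔ₛ′ to from to∘from from∘to
  where
  longer : ∀ {c r m} → c + r + c ≡ m → c + suc r + c ≡ suc m
  longer {c} {r} e = trans (cong (_+ c) (+-suc c r)) (cong suc e)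
  shorter : ∀ {c r m} → c + suc r + c ≡ suc m → c + r + c ≡ m
  shorter {c} {r} e = suc-injective (trans (cong (_+ c) (sym (+-suc c r))) e)

  to : Split n (λ c r → Shells c × Invs r q) → Split (suc n) (λ c r → Shells c × Invs r q′)
  to (c , r , e , s , x) = c , suc r , longer {c} {r} e , s , Inverse.to per-middle x
  from : Split (suc n) (λ c r → Shells c × Invs r q′) → Split n (λ c r → Shells c × Invs r q)
  from (c , zero  , e , s , y) = ⊥-elim (empty y)
  from (c , suc r , e , s , y) = c , r , shorter {c} {r} e , s , Inverse.from per-middle y

  to∘from : ∀ y → to (from y) ≡ y
  to∘from (c , zero  , e , s , y) = ⊥-elim (empty y)
  to∘from (c , suc r , e , s , y) =
    cong₂ (λ e y → c , suc r , e , s , y) (≡-irrelevant _ e) (Inverse.strictlyInverseˡ (per-middle {r}) y)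
  from∘to : ∀ x → from (to x) ≡ x
  from∘to (c , r , e , s , x) =
    cong₂ (λ e x → c , r , e , s , x) (≡-irrelevant _ e) (Inverse.strictlyInverseʳ (per-middle {r}) x)

Split-Shelled-≡ : ∀ {n q c r c′ r′ e e′} {x : Shelled c r q} {x′ : Shelled c′ r′ q} → c ≡ c′ → r ≡ r′ →
  ⌊ proj₁ x ⌋ ≈[ c + r + c ] ⌊ proj₁ x′ ⌋
  → _≡_ {A = Split n (λ c r → Shelled c r q)} (c , r , e , x) (c′ , r′ , e′ , x′)
Split-Shelled-≡ {n} {q} {c} {r} refl refl x≈x′ =
  cong₂ {C = Split n (λ c r → Shelled c r q)} (λ e x → c , r , e , x) (≡-irrelevant _ _) (Shelled-≡ {q = q} x≈x′)

module RemoveTopCycle {n : ℕ} {q : ℕ → Bool} (q1≡false : q 1 ≡ false) where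

  Removed : Set
  Removed = Split n (λ c r → Shelled c r (λ x → q (2 + x)))

  private
    moved : (p : Inv132 (suc (suc n))) → T (q (#RLMax (suc (suc n)) ⌊ p ⌋)) → ⌊ p ⌋ (suc n) ≢ suc n
    moved p rl fixed = subst T (trans (cong q (LastEntry.#RLMax-fixed (Inv132⇒Is132Inv p) fixed)) q1≡false) rl

    module Remove (p : Inv132 (suc (suc n))) (rl : T (q (#RLMax (suc (suc n)) ⌊ p ⌋))) where
      open DeleteTop (Inv132⇒Is132Inv p) (moved p rl) public
      m = ⌊ p ⌋ (suc n)
      D = deleteTop n ⌊ p ⌋
      s = proj₁ shell
      n≡ = proj₁ (proj₂ shell)
      D-is132Inv = subst (λ z → Is132Inv z D) n≡ is132Inv
      D-rl : T (q (2 + #RLMax s (middle m D)))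
      D-rl = subst (T ∘ q) (trans (#RLMax-cong (≈-sym insertTop-deleteTop))
                                  (InsertTop.#RLMax-insertTop n≡ is132Inv (proj₂ (proj₂ shell)))) rl
      result : Removed
      result = m , s , sym n≡ , toShelled {q = λ x → q (2 + x)} D D-is132Inv (proj₂ (proj₂ shell)) D-rl

    module Insert (c r : ℕ) (e : c + r + c ≡ n) (p : Inv132 (c + r + c)) (shell? : True (shell? c r ⌊ p ⌋))
                  (rl : T (q (2 + #RLMax r (middle c ⌊ p ⌋)))) where
      π = subst (λ z → Is132Inv z ⌊ p ⌋) e (Inv132⇒Is132Inv p)
      open InsertTop (sym e) π (toWitness shell?) public
      open ShellFacts (sym e) π (toWitness shell?) using (c≤n) public
      result : Invs (suc (suc n)) q
      result = toInvs {q = q} (insertTop c n ⌊ p ⌋) is132Inv (subst (T ∘ q) (sym #RLMax-insertTop) rl)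

    remove : Invs (suc (suc n)) q → Removed
    remove (p , rl) = Remove.result p rl

    insert : Removed → Invs (suc (suc n)) q
    insert (c , r , e , p , shell? , rl) = Insert.result c r e p shell? rl

    remove∘insert : (y : Removed) → remove (insert y) ≡ y
    remove∘insert (c , r , e , p , shell? , rl) = Split-Shelled-≡ {q = λ x → q (2 + x)} m≡c s≡r
      (≈-trans (⌊toInv132⌋ _ D R.D-is132Inv)
        (subst (λ z → D ≈[ z ] ⌊ p ⌋) R.n≡
          (≈-trans (deleteTop-cong (⌊toInv132⌋ _ _ I.is132Inv)) (deleteTop-insertTop I.c≤n))))
      where
      module I = Insert c r e p shell? rl
      module R = Remove (proj₁ I.result) (proj₂ I.result)
      open R using (m; D; s)
      m≡c : m ≡ c
      m≡c = trans (⌊toInv132⌋ _ _ I.is132Inv (n<1+n (suc n))) (insertTop-last {g = ⌊ p ⌋} I.c≤n)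
      s≡r : s ≡ r
      s≡r = middle-width-unique {m} (trans (sym R.n≡) (trans (sym e) (cong (λ z → z + r + z) (sym m≡c))))

    insert∘remove : (x : Invs (suc (suc n)) q) → insert (remove x) ≡ x
    insert∘remove (p , rl) = Invs-≡ {q = q} (≈-trans (⌊toInv132⌋ _ _ I.is132Inv)
      (≈-trans (insertTop-cong R.m≤n
                                   (subst (λ z → ⌊ proj₁ y ⌋ ≈[ z ] R.D) (sym R.n≡) (⌊toInv132⌋ _ _ R.D-is132Inv)))
               R.insertTop-deleteTop))
      where
      module R = Remove p rl
      y = proj₂ (proj₂ (proj₂ R.result))
      module I = Insert R.m R.s (sym R.n≡) (proj₁ y) (proj₁ (proj₂ y)) (proj₂ (proj₂ y))

  Invs↔Removed : Invs (suc (suc n)) q ↔ Removed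
  Invs↔Removed = mk↔ₛ′ remove insert remove∘insert insert∘remove

Invs-fixedLast : ∀ {n} → Invs (suc n) (_≡ᵇ 1) ↔ Invs n (λ _ → true)
Invs-fixedLast {n} = mk↔ₛ′ to from to∘from from∘to
  where
  fixed : ∀ p → T (#RLMax (suc n) ⌊ p ⌋ ≡ᵇ 1) → ⌊ p ⌋ n ≡ n
  fixed p rl with ⌊ p ⌋ n ≟ n
  ... | yes fn≡n = fn≡n
  ... | no  moved = ⊥-elim (<⇒≱ (LastEntry.2≤#RLMax-moved (Inv132⇒Is132Inv p) moved) (≤-reflexive (≡ᵇ⇒≡ _ 1 rl)))

  init-π : ∀ p rl → Is132Inv n ⌊ p ⌋
  init-π p rl = init-is132Inv (Inv132⇒Is132Inv p) (fixed p rl)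

  append-π : ∀ (p : Inv132 n) → Is132Inv (suc n) (appendFixed n ⌊ p ⌋)
  append-π p = appendFixed-is132Inv (Inv132⇒Is132Inv p)

  to : Invs (suc n) (_≡ᵇ 1) → Invs n (λ _ → true)
  to (p , rl) = toInvs {q = λ _ → true} ⌊ p ⌋ (init-π p rl) _

  from : Invs n (λ _ → true) → Invs (suc n) (_≡ᵇ 1)
  from (p , _) = toInvs {q = _≡ᵇ 1} (appendFixed n ⌊ p ⌋) (append-π p)
    (≡⇒≡ᵇ _ 1 (LastEntry.#RLMax-fixed (append-π p) (appendFixed-last {n} {⌊ p ⌋})))

  to∘from : ∀ y → to (from y) ≡ y
  to∘from y@(p , _) = Invs-≡ {q = λ _ → true} (≈-trans (⌊toInv132⌋ n _ (init-π p′ rl′))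
    (≈-trans (λ i<n → ⌊toInv132⌋ (suc n) _ (append-π p) (m<n⇒m<1+n i<n)) (appendFixed-< {n} {⌊ p ⌋})))
    where p′ = proj₁ (from y)
          rl′ = proj₂ (from y)

  from∘to : ∀ x → from (to x) ≡ x
  from∘to x@(p , rl) = Invs-≡ {q = _≡ᵇ 1} (≈-trans (⌊toInv132⌋ (suc n) _ (append-π (proj₁ (to x))))
    (≈-trans (appendFixed-cong (⌊toInv132⌋ n _ (init-π p rl))) (appendFixed-init (fixed p rl))))

AtMostOne : ℕ → Bool
AtMostOne x = (x ≡ᵇ 0) ∨ (x ≡ᵇ 1)

AtMostOne⇔≤1 : ∀ {x} → T (AtMostOne x) ⇔ x ≤ 1
AtMostOne⇔≤1 = mk⇔ to from
  where
  to : ∀ {x} → T (AtMostOne x) → x ≤ 1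
  to {zero}        _ = z≤n
  to {suc zero}    _ = s≤s z≤n
  from : ∀ {x} → x ≤ 1 → T (AtMostOne x)
  from z≤n       = _
  from (s≤s z≤n) = _

Invs↔Widest : ∀ {n} → Invs n (λ _ → true) ↔ Split n (λ c r → Shelled c r AtMostOne)
Invs↔Widest {n} = mk↔ₛ′ to from to∘from from∘to
  where
  cast : ∀ {m f} → Is132Inv m f → ∀ {m′} → m ≡ m′ → Is132Inv m′ f
  cast {f = f} π e = subst (λ z → Is132Inv z f) e π

  to : Invs n (λ _ → true) → Split n (λ c r → Shelled c r AtMostOne)
  to (p , _) = c₀ , r₀ , sym n≡₀ ,
    toShelled {q = AtMostOne} ⌊ p ⌋ (cast (Inv132⇒Is132Inv p) n≡₀) shell₀
              (Equivalence.from AtMostOne⇔≤1 middle-#RLMax≤1)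
    where open WidestShell (Inv132⇒Is132Inv p)

  from : Split n (λ c r → Shelled c r AtMostOne) → Invs n (λ _ → true)
  from (c , r , e , p , _) = toInvs {q = λ _ → true} ⌊ p ⌋ (cast (Inv132⇒Is132Inv p) e) _

  to∘from : ∀ y → to (from y) ≡ y
  to∘from y@(c , r , e , p , shell? , rl) = Split-Shelled-≡ {q = AtMostOne} c₀≡c r₀≡r
    (≈-trans (⌊toInv132⌋ _ _ (cast π′ n≡₀)) (subst (λ z → ⌊ p′ ⌋ ≈[ z ] ⌊ p ⌋) n≡₀ f≈))
    where
    p′ = proj₁ (from y)
    π′ = Inv132⇒Is132Inv p′
    f≈ : ⌊ p′ ⌋ ≈[ n ] ⌊ p ⌋
    f≈ = ⌊toInv132⌋ n ⌊ p ⌋ (cast (Inv132⇒Is132Inv p) e)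
    f≈′ : ⌊ p′ ⌋ ≈[ c + r + c ] ⌊ p ⌋
    f≈′ = subst (λ z → ⌊ p′ ⌋ ≈[ z ] ⌊ p ⌋) (sym e) f≈
    open WidestShell π′
    c₀≡c : c₀ ≡ c
    c₀≡c = sym (widest-unique (sym e) (Shell-resp refl (≈-sym f≈′) (toWitness shell?))
                 (subst (_≤ 1) (#RLMax-cong (middle-cong {c} {r} (≈-sym f≈′))) (Equivalence.to AtMostOne⇔≤1 rl)))
    r₀≡r : r₀ ≡ r
    r₀≡r = middle-width-unique {c} (trans (cong (λ z → z + r₀ + z) (sym c₀≡c)) (trans (sym n≡₀) (sym e)))

  from∘to : ∀ x → from (to x) ≡ x
  from∘to x@(p , _) = Invs-≡ {q = λ _ → true}
    (≈-trans (⌊toInv132⌋ n _ (cast (Inv132⇒Is132Inv p′) (sym n≡₀)))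
             (subst (λ z → ⌊ p′ ⌋ ≈[ z ] ⌊ p ⌋) (sym n≡₀) (⌊toInv132⌋ _ ⌊ p ⌋ (cast (Inv132⇒Is132Inv p) n≡₀))))
    where
    open WidestShell (Inv132⇒Is132Inv p)
    p′ = proj₁ (proj₂ (proj₂ (proj₂ (to x))))

-- odd l = 2 l + 1, by a recursion under which removing the two-cycle through the maximum
-- turns the conditions for l + 1 into those for l definitionally
odd : ℕ → ℕ
odd zero    = 1
odd (suc l) = suc (suc (odd l))

Odd Next : ℕ → ℕ → Bool
Odd  l x = x ≡ᵇ odd l
Next l x = (x ≡ᵇ suc (odd l)) ∨ (x ≡ᵇ suc (suc (odd l)))

Next-1 : ∀ l → Next l 1 ≡ false
Next-1 zero    = refl
Next-1 (suc l) = refl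

Invs-empty : ∀ {n q} → (∀ {x} → x ≤ n → q x ≡ false) → ¬ Invs n q
Invs-empty {n} {q} never (p , rl) = subst T (never (count≤ n _)) rl

↔-empty : ∀ {A B : Set} → ¬ A → ¬ B → A ↔ B
↔-empty ¬a ¬b = mk↔ₛ′ (⊥-elim ∘ ¬a) (⊥-elim ∘ ¬b) (⊥-elim ∘ ¬b) (⊥-elim ∘ ¬a)

Odd↔Next : ∀ l n → Invs n (Odd l) ↔ Invs (suc n) (Next l)
Odd↔Next zero zero =
  ↔-empty (Invs-empty {q = Odd 0} λ { z≤n → refl }) (Invs-empty {q = Next 0} λ { z≤n → refl ; (s≤s z≤n) → refl })
Odd↔Next zero (suc n) = begin
  Invs (suc n) (Odd 0)                         ↔⟨ Invs-fixedLast ⟩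
  Invs n (λ _ → true)                          ↔⟨ Invs↔Widest ⟩
  Split n (λ c r → Shelled c r AtMostOne)      ↔⟨ RemoveTopCycle.Invs↔Removed {q = Next 0} (Next-1 0) ⟨
  Invs (suc (suc n)) (Next 0)                  ∎
  where open EquationalReasoning
Odd↔Next (suc l) zero =
  ↔-empty (Invs-empty {q = Odd (suc l)} λ { z≤n → refl })
          (Invs-empty {q = Next (suc l)} λ { z≤n → refl ; (s≤s z≤n) → refl })
Odd↔Next (suc l) (suc zero) =
  ↔-empty (Invs-empty {q = Odd (suc l)} λ { z≤n → refl ; (s≤s z≤n) → refl })
          (Invs-empty {q = Next (suc l)} λ { z≤n → refl ; (s≤s z≤n) → refl ; (s≤s (s≤s z≤n)) → refl })
Odd↔Next (suc l) (suc (suc n)) = begin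
  Invs (suc (suc n)) (Odd (suc l))                    ↔⟨ RemoveTopCycle.Invs↔Removed {q = Odd (suc l)} refl ⟩
  Split n (λ c r → Shelled c r (Odd l))               ↔⟨ Split-cong (Shelled↔Shells×Invs {q = Odd l}) ⟩
  Split n (λ c r → Shells c × Invs r (Odd l))         ↔⟨ Split-middle-suc {q = Odd l} {Next l} (Odd↔Next l _) (λ ()) ⟩
  Split (suc n) (λ c r → Shells c × Invs r (Next l))  ↔⟨ Split-cong (Shelled↔Shells×Invs {q = Next l}) ⟨
  Split (suc n) (λ c r → Shelled c r (Next l))        ↔⟨ RemoveTopCycle.Invs↔Removed {q = Next (suc l)} q1 ⟨
  Invs (suc (suc (suc n))) (Next (suc l))             ∎
  where open EquationalReasoning
        q1 = Next-1 (suc l)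

odd+ : ∀ l i → 2 * l + suc i ≡ i + odd l
odd+ zero    i = +-comm 1 i
odd+ (suc l) i = begin
  2 * suc l + suc i       ≡⟨ step l i ⟩
  2 + (2 * l + suc i)     ≡⟨ cong (2 +_) (odd+ l i) ⟩
  2 + (i + odd l)         ≡⟨ cong suc (+-suc i (odd l)) ⟨
  suc (i + suc (odd l))   ≡⟨ +-suc i (suc (odd l)) ⟨
  i + odd (suc l)         ∎
  where
  open ≡-Reasoning
  step : ∀ l i → 2 * suc l + suc i ≡ 2 + (2 * l + suc i)
  step = solve-∀

Σ-rlMax↔Invs : ∀ {m} {P : ℕ → Set} {q : ℕ → Bool} → (∀ x → P x ↔ T (q x)) →
               Σ (Inv132 m) (λ p → P (rlMax (proj₁ p))) ↔ Invs m q
Σ-rlMax↔Invs {P = P} {q} P↔q = Σ-↔ ↔-refl λ {p} →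
  subst (λ z → P (rlMax (proj₁ p)) ↔ T (q z)) (rlMax≡#RLMax (proj₁ p)) (P↔q _)

≡↔T≡ᵇ : ∀ {x r} → (x ≡ r) ↔ T (x ≡ᵇ r)
≡↔T≡ᵇ {x} {r} = mk↔ₛ′ (≡⇒≡ᵇ x r) (≡ᵇ⇒≡ x r) (λ _ → T-irrelevant _ _) (λ _ → ≡-irrelevant _ _)

⊎↔T∨ : ∀ {x a b} → a ≢ b → (x ≡ a ⊎ x ≡ b) ↔ T ((x ≡ᵇ a) ∨ (x ≡ᵇ b))
⊎↔T∨ {x} {a} {b} a≢b = mk↔ₛ′ to from (λ _ → T-irrelevant _ _) (λ _ → irrelevant _ _)
  where
  to : x ≡ a ⊎ x ≡ b → T ((x ≡ᵇ a) ∨ (x ≡ᵇ b))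
  to = Equivalence.from T-∨ ∘ Sum.map (≡⇒≡ᵇ x a) (≡⇒≡ᵇ x b)
  from : T ((x ≡ᵇ a) ∨ (x ≡ᵇ b)) → x ≡ a ⊎ x ≡ b
  from = Sum.map (≡ᵇ⇒≡ x a) (≡ᵇ⇒≡ x b) ∘ Equivalence.to T-∨
  irrelevant : (u v : x ≡ a ⊎ x ≡ b) → u ≡ v
  irrelevant (inj₁ x≡a) (inj₁ x≡a′) = cong inj₁ (≡-irrelevant x≡a x≡a′)
  irrelevant (inj₂ x≡b) (inj₂ x≡b′) = cong inj₂ (≡-irrelevant x≡b x≡b′)
  irrelevant (inj₁ x≡a) (inj₂ x≡b)  = ⊥-elim (a≢b (trans (sym x≡a) x≡b))
  irrelevant (inj₂ x≡b) (inj₁ x≡a)  = ⊥-elim (a≢b (trans (sym x≡a) x≡b))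

lemma4p7 : (l k : ℕ) → l ≤ k →
    (Σ (Inv132 (2 * k + 1)) λ p → rlMax (proj₁ p) ≡ 2 * l + 1)
      ⤖ (Σ (Inv132 (2 * k + 2)) λ p → (rlMax (proj₁ p) ≡ 2 * l + 2) ⊎ (rlMax (proj₁ p) ≡ 2 * l + 3))
lemma4p7 l k _ rewrite odd+ l 0 | odd+ l 1 | odd+ l 2 | +-suc (2 * k) 1 = ↔⇒⤖ (begin
  Σ (Inv132 n) (λ p → rlMax (proj₁ p) ≡ odd l)                  ↔⟨ Σ-rlMax↔Invs odd-rl ⟩
  Invs n (Odd l)                                                   ↔⟨ Odd↔Next l n ⟩
  Invs (suc n) (Next l)                                            ↔⟨ Σ-rlMax↔Invs next-rl ⟨
  Σ (Inv132 (suc n)) (λ p → rlMax (proj₁ p) ≡ suc (odd l) ⊎ rlMax (proj₁ p) ≡ suc (suc (odd l))) ∎)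
  where
  open EquationalReasoning
  n = 2 * k + 1
  odd-rl : ∀ x → (x ≡ odd l) ↔ T (Odd l x)
  odd-rl _ = ≡↔T≡ᵇ
  next-rl : ∀ x → (x ≡ suc (odd l) ⊎ x ≡ suc (suc (odd l))) ↔ T (Next l x)
  next-rl _ = ⊎↔T∨ (<⇒≢ (n<1+n (suc (odd l))))
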